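{- For every integer $n\ge 3$, $$2n-2-\sqrt{(4n-8)\ln(4n-4)}\ \le\ a(K_{1,n-1})\ \le\ 2n-2,$$ where $K_{1,n-1}$ is the star with $n-1$ edges.
   Context: For a finite graph $G$ with no isolated vertices, the achievement game of $G$ on $K_N$ is played by Alice and Bob on the edges of the complete graph $K_N$, all initially uncolored: in each round Alice first colors one uncolored edge blue, then Bob colors one uncolored edge red. The player who first completes a copy of $G$ entirely in his or her own color wins; otherwise the game is a draw. The achievement number $a(G)$ is the smallest $N$ for which Alice has a winning strategy in this game on $K_N$. -}

module Defs where

open import Data.Nat using (ℕ; zero; suc; _+_; _*_; _∸_; _^_; _≤_; _!)
open import Data.Fin using (Fin) renaming (zero to fzero; _<_ to _<ᶠ_)
open import Data.Product using (Σ; _×_; _,_; ∃)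
open import Data.Sum using (_⊎_)
open import Data.List using (List; []; _∷_)
open import Data.List.Membership.Propositional using (_∈_; _∉_)
open import Relation.Binary.PropositionalEquality using (_≡_; _≢_)
open import Relation.Nullary using (¬_)
open import Function.Definitions using (Injective)

record Graph : Set₁ where
  field
    size : ℕ
    Adj  : Fin size → Fin size → Set

open Graph public

Star : ℕ → Graph
Star k = record
  { size = suc k
  ; Adj  = λ u v → (u ≡ fzero × v ≢ fzero) ⊎ (v ≡ fzero × u ≢ fzero)
  }

-- The board K_N.  An edge {i,j} is represented by the ordered pair (i , j)
-- with i < j.  A set of coloured edges is a list of such pairs.

Edge : ℕ → Set
Edge N = Fin N × Fin N

EdgeRel : ∀ {N} → List (Edge N) → Fin N → Fin N → Set
EdgeRel es u v = ((u , v) ∈ es) ⊎ ((v , u) ∈ es)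

HasCopy : (G : Graph) → ∀ {N} → List (Edge N) → Set
HasCopy G {N} es =
  Σ (Fin (size G) → Fin N) λ f →
    Injective _≡_ _≡_ f × (∀ u v → Adj G u v → EdgeRel es (f u) (f v))

Free : ∀ {N} → Edge N → List (Edge N) → List (Edge N) → Set
Free (i , j) B R = (i <ᶠ j) × ((i , j) ∉ B) × ((i , j) ∉ R)

-- Since the game is
-- finite, well-founded (inductive) winning strategies are exactly the
-- winning strategies.

data AliceWins (G : Graph) (N : ℕ) (B R : List (Edge N)) : Set where
  win-now  : (e : Edge N) → Free e B R → HasCopy G (e ∷ B) → AliceWins G N B R
  -- Alice colours a free edge e blue; afterwards some edge is still free
  -- (otherwise the game ends in a draw), and for every reply e' of Bob,
  -- Bob does not complete a red copy of G and Alice wins from the new position.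
  continue : (e : Edge N) → Free e B R →
             (∃ λ e' → Free e' (e ∷ B) R) →
             (∀ e' → Free e' (e ∷ B) R →
                (¬ HasCopy G (e' ∷ R)) × AliceWins G N (e ∷ B) (e' ∷ R)) →
             AliceWins G N B R

AliceWinsOn : Graph → ℕ → Set
AliceWinsOn G N = AliceWins G N [] []

AchNumber≤ : Graph → ℕ → Set
AchNumber≤ G M = ∃ λ N → N ≤ M × AliceWinsOn G N

-- "P N ≤ a(G)" for an upward-closed-as-a-bound predicate P: every N for which
-- Alice wins (in particular the least one) satisfies P.
AchNumberSatisfies : Graph → (ℕ → Set) → Set
AchNumberSatisfies G P = ∀ N → AliceWinsOn G N → P N

-- Exponential series, scaled to stay in ℕ:
--   expScaled x J = J! * Σ_{j=0}^{J} x^j / j!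
-- (recursion: expScaled x 0 = 1, expScaled x (J+1) = (J+1)·expScaled x J + x^(J+1)).
expScaled : ℕ → ℕ → ℕ
expScaled x zero    = 1
expScaled x (suc J) = suc J * expScaled x J + x ^ suc J

-- For naturals x, M:  e^x ≤ M  ⇔  every partial sum Σ_{j≤J} x^j/j! is ≤ M.
ExpLe : ℕ → ℕ → Set
ExpLe x M = ∀ J → expScaled x J ≤ M * (J !)

-- StarLowerBound n N  ⇔  2n-2 - sqrt((4n-8) ln(4n-4)) ≤ N   (for n ≥ 3).
-- With k = max(0, 2n-2-N):  k ≤ sqrt((4n-8) ln(4n-4))
--   ⇔ k² ≤ (4n-8) ln(4n-4)  ⇔  e^(k²) ≤ (4n-4)^(4n-8).
StarLowerBound : ℕ → ℕ → Set
StarLowerBound n N =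
  let k = (2 * n ∸ 2) ∸ N in
  ExpLe (k * k) ((4 * n ∸ 4) ^ (4 * n ∸ 8))

{-# OPTIONS --safe #-}
module Submission where

-- Upper bound: on K_{2n-2} Alice only claims edges at one fixed vertex. Before her
-- (n-1)-st move at most 2n-4 of the 2n-3 edges there are coloured, so she always has
-- a free one, and Bob, who owns at most n-2 edges, never completes a star first.
--
-- Lower bound: Bob plays an Erdős–Selfridge type weighting strategy. With 0 ≤ p ≤ q,
-- every pair of vertices gets the factor q + p, q - p or q according as it is blue,
-- red or free; a vertex weighs the product of its factors and Φ is the total weight.
-- Answering each blue edge with the free edge of largest endpoint weight keeps
-- q Φ + p W(g) ≤ q^N (N q + 2 p) for every free edge g, so a blue star K_{1,d} on
-- K_N forces (q + p)^d (q - p)^(N-d) ≤ q^(N-1) (N q + 2 p). For q = N and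
-- p = k = 2d - N this yields e^(k²) ≤ (4d)^(4d-4) by means of the estimates
-- e^(2u) ≤ (1 + u)/(1 - u) and 1 + w ≤ e^w, all proved for the partial sums of the
-- exponential series over ℚ.

open import Algebra.Bundles using (CommutativeMonoid)
open import Data.Nat using (ℕ)

module RationalArithmetic where
  open import Data.Nat as ℕ using (ℕ; zero; suc; NonZero)
  import Data.Nat.Properties as ℕ
  open import Data.Rational using (ℚ; 0ℚ; 1ℚ; _+_; _*_; 1/_; _≤_; _<_; positive; nonNegative; >-nonZero)
  open import Data.Rational.Properties
  open import Data.Rational.Solver using (module +-*-Solver)
  open +-*-Solver using (solve; _:*_; _:=_)
  open import Algebra.Bundles using (CommutativeRing)
  open import Algebra.Properties.CommutativeSemiring.Exp (CommutativeRing.commutativeSemiring +-*-commutativeRing)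
    using (_^_; ^-distrib-*)
  open import Algebra.Properties.Semiring.Mult (CommutativeRing.semiring +-*-commutativeRing)
    using (_×_; ×-homo-+; ×1-homo-*)
  open import Data.Sum using (inj₁; inj₂)
  open import Relation.Binary.PropositionalEquality
  open import Relation.Nullary using (contradiction)

  0<1 : 0ℚ < 1ℚ
  0<1 = positive⁻¹ 1ℚ

  *-monoˡ-≤ : ∀ {r p q} → 0ℚ ≤ r → p ≤ q → r * p ≤ r * q
  *-monoˡ-≤ {r} 0≤r = *-monoˡ-≤-nonNeg r {{nonNegative 0≤r}}

  *-monoʳ-≤ : ∀ {r p q} → 0ℚ ≤ r → p ≤ q → p * r ≤ q * r
  *-monoʳ-≤ {r} 0≤r = *-monoʳ-≤-nonNeg r {{nonNegative 0≤r}}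

  *-mono-≤ : ∀ {p q r s} → 0ℚ ≤ p → 0ℚ ≤ r → p ≤ q → r ≤ s → p * r ≤ q * s
  *-mono-≤ 0≤p 0≤r p≤q r≤s = ≤-trans (*-monoˡ-≤ 0≤p r≤s) (*-monoʳ-≤ (≤-trans 0≤r r≤s) p≤q)

  *-nonNeg : ∀ {p q} → 0ℚ ≤ p → 0ℚ ≤ q → 0ℚ ≤ p * q
  *-nonNeg {p} {q} 0≤p 0≤q = nonNegative⁻¹ _ {{nonNeg*nonNeg⇒nonNeg p {{nonNegative 0≤p}} q {{nonNegative 0≤q}}}}

  *-pos : ∀ {p q} → 0ℚ < p → 0ℚ < q → 0ℚ < p * q
  *-pos {p} {q} 0<p 0<q = positive⁻¹ _ {{pos*pos⇒pos p {{positive 0<p}} q {{positive 0<q}}}}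

  p≤p+q : ∀ {p q} → 0ℚ ≤ q → p ≤ p + q
  p≤p+q {p} 0≤q = ≤-trans (≤-reflexive (sym (+-identityʳ p))) (+-monoʳ-≤ p 0≤q)

  ^-nonNeg : ∀ {x} n → 0ℚ ≤ x → 0ℚ ≤ x ^ n
  ^-nonNeg zero    _   = <⇒≤ 0<1
  ^-nonNeg (suc n) 0≤x = *-nonNeg 0≤x (^-nonNeg n 0≤x)

  ^-pos : ∀ {x} n → 0ℚ < x → 0ℚ < x ^ n
  ^-pos zero    _   = 0<1
  ^-pos (suc n) 0<x = *-pos 0<x (^-pos n 0<x)

  ι : ℕ → ℚ
  ι n = n × 1ℚ

  ι-+ : ∀ m n → ι (m ℕ.+ n) ≡ ι m + ι n
  ι-+ = ×-homo-+ 1ℚ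

  ι-* : ∀ m n → ι (m ℕ.* n) ≡ ι m * ι n
  ι-* = ×1-homo-*

  ι-*³ : ∀ a b c → ι (a ℕ.* b ℕ.* c) ≡ ι a * ι b * ι c
  ι-*³ a b c = trans (ι-* (a ℕ.* b) c) (cong (_* ι c) (ι-* a b))

  ι-^ : ∀ m n → ι (m ℕ.^ n) ≡ ι m ^ n
  ι-^ m zero    = +-identityʳ 1ℚ
  ι-^ m (suc n) = trans (ι-* m (m ℕ.^ n)) (cong (ι m *_) (ι-^ m n))

  ι-nonNeg : ∀ n → 0ℚ ≤ ι n
  ι-nonNeg zero    = ≤-refl
  ι-nonNeg (suc n) = +-mono-≤ {0ℚ} {1ℚ} (<⇒≤ 0<1) (ι-nonNeg n)

  ι-pos : ∀ n .{{_ : NonZero n}} → 0ℚ < ι n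
  ι-pos (suc n) = +-mono-<-≤ {0ℚ} {1ℚ} 0<1 (ι-nonNeg n)

  ι-mono-≤ : ∀ {m n} → m ℕ.≤ n → ι m ≤ ι n
  ι-mono-≤ {zero}  {n}     _           = ι-nonNeg n
  ι-mono-≤ {suc m} {suc n} (ℕ.s≤s m≤n) = +-monoʳ-≤ 1ℚ (ι-mono-≤ m≤n)

  ι-cancel-≤ : ∀ {m n} → ι m ≤ ι n → m ℕ.≤ n
  ι-cancel-≤ {m} {n} ιm≤ιn with ℕ.≤-<-connex m n
  ... | inj₁ m≤n = m≤n
  ... | inj₂ n<m = contradiction (<-≤-trans ιn<ι[1+n] (≤-trans (ι-mono-≤ n<m) ιm≤ιn)) (<-irrefl refl)
    where
    ιn<ι[1+n] : ι n < ι (suc n)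
    ιn<ι[1+n] = subst (_< ι (suc n)) (+-identityˡ (ι n)) (+-mono-<-≤ 0<1 (≤-refl {ι n}))

  _/ℕ_ : ℚ → (n : ℕ) → .{{NonZero n}} → ℚ
  p /ℕ n = p * (1/ ι n) {{>-nonZero (ι-pos n)}}

  [ιn*p]/ℕn≡p : ∀ p n .{{_ : NonZero n}} → (ι n * p) /ℕ n ≡ p
  [ιn*p]/ℕn≡p p n = begin
    ι n * p * 1/ ι n   ≡⟨ solve 3 (λ a b c → a :* b :* c := b :* (a :* c)) refl (ι n) p (1/ ι n) ⟩
    p * (ι n * 1/ ι n) ≡⟨ cong (p *_) (*-inverseʳ (ι n)) ⟩
    p * 1ℚ             ≡⟨ *-identityʳ p ⟩
    p                  ∎
    where
    open ≡-Reasoning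
    instance _ = >-nonZero (ι-pos n)

  ιn*[p/ℕn]≡p : ∀ p n .{{_ : NonZero n}} → ι n * (p /ℕ n) ≡ p
  ιn*[p/ℕn]≡p p n = trans (sym (*-assoc (ι n) p _)) ([ιn*p]/ℕn≡p p n)

  ι-*-cancelˡ : ∀ n .{{_ : NonZero n}} {p q} → ι n * p ≡ ι n * q → p ≡ q
  ι-*-cancelˡ n {p} {q} eq = trans (sym ([ιn*p]/ℕn≡p p n)) (trans (cong (_/ℕ n) eq) ([ιn*p]/ℕn≡p q n))

  0≤1/ι : ∀ n .{{_ : NonZero n}} → 0ℚ ≤ (1/ ι n) {{>-nonZero (ι-pos n)}}
  0≤1/ι n = <⇒≤ (positive⁻¹ _ {{1/pos⇒pos (ι n) {{positive (ι-pos n)}}}})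

  /ℕ-monoˡ-≤ : ∀ {p q} n .{{_ : NonZero n}} → p ≤ q → p /ℕ n ≤ q /ℕ n
  /ℕ-monoˡ-≤ n = *-monoʳ-≤ (0≤1/ι n)

  /ℕ-nonNeg : ∀ {p} n .{{_ : NonZero n}} → 0ℚ ≤ p → 0ℚ ≤ p /ℕ n
  /ℕ-nonNeg n 0≤p = *-nonNeg 0≤p (0≤1/ι n)

  0/ℕn≡0 : ∀ n .{{_ : NonZero n}} → 0ℚ /ℕ n ≡ 0ℚ
  0/ℕn≡0 n = *-zeroˡ ((1/ ι n) {{>-nonZero (ι-pos n)}})

  ιn/ℕn≡1 : ∀ n .{{_ : NonZero n}} → ι n /ℕ n ≡ 1ℚ
  ιn/ℕn≡1 n = trans (cong (_/ℕ n) (sym (*-identityʳ (ι n)))) ([ιn*p]/ℕn≡p 1ℚ n)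

  _÷_ : ℕ → (n : ℕ) → .{{NonZero n}} → ℚ
  a ÷ n = ι a /ℕ n

  ÷-nonNeg : ∀ a n .{{_ : NonZero n}} → 0ℚ ≤ a ÷ n
  ÷-nonNeg a n = /ℕ-nonNeg n (ι-nonNeg a)

  ÷-pos : ∀ a n .{{_ : NonZero a}} .{{_ : NonZero n}} → 0ℚ < a ÷ n
  ÷-pos a n = *-pos (ι-pos a) (positive⁻¹ _ {{1/pos⇒pos (ι n) {{positive (ι-pos n)}}}})

  1+[a÷n]≡[n+a]÷n : ∀ a n .{{_ : NonZero n}} → 1ℚ + a ÷ n ≡ (n ℕ.+ a) ÷ n
  1+[a÷n]≡[n+a]÷n a n = ι-*-cancelˡ n (begin
    ι n * (1ℚ + a ÷ n)        ≡⟨ *-distribˡ-+ (ι n) 1ℚ (a ÷ n) ⟩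
    ι n * 1ℚ + ι n * (a ÷ n)  ≡⟨ cong₂ _+_ (*-identityʳ (ι n)) (ιn*[p/ℕn]≡p (ι a) n) ⟩
    ι n + ι a                 ≡⟨ sym (ι-+ n a) ⟩
    ι (n ℕ.+ a)               ≡⟨ sym (ιn*[p/ℕn]≡p (ι (n ℕ.+ a)) n) ⟩
    ι n * ((n ℕ.+ a) ÷ n)     ∎)
    where open ≡-Reasoning

  [a÷n]^j*ι[n^j]≡ι[a^j] : ∀ a n j .{{_ : NonZero n}} → (a ÷ n) ^ j * ι (n ℕ.^ j) ≡ ι (a ℕ.^ j)
  [a÷n]^j*ι[n^j]≡ι[a^j] a n j = begin
    (a ÷ n) ^ j * ι (n ℕ.^ j)    ≡⟨ cong ((a ÷ n) ^ j *_) (ι-^ n j) ⟩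
    (a ÷ n) ^ j * ι n ^ j        ≡⟨ sym (^-distrib-* (a ÷ n) (ι n) j) ⟩
    ((a ÷ n) * ι n) ^ j          ≡⟨ cong (_^ j) (trans (*-comm (a ÷ n) (ι n)) (ιn*[p/ℕn]≡p (ι a) n)) ⟩
    ι a ^ j                      ≡⟨ sym (ι-^ a j) ⟩
    ι (a ℕ.^ j)                  ∎
    where open ≡-Reasoning

  ≤-by-clearing : ∀ {c p q a b} → 0ℚ < c → c * p ≡ ι a → c * q ≡ ι b → a ℕ.≤ b → p ≤ q
  ≤-by-clearing {c} 0<c cp≡ιa cq≡ιb a≤b =
    *-cancelˡ-≤-pos c {{positive 0<c}} (subst₂ _≤_ (sym cp≡ιa) (sym cq≡ιb) (ι-mono-≤ a≤b))

module CauchyProduct where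
  open RationalArithmetic
  open import Data.Nat using (ℕ; zero; suc)
  open import Data.Rational using (ℚ; 0ℚ; 1ℚ; _+_; _*_; _≤_)
  open import Data.Rational.Properties
  open import Data.Rational.Solver using (module +-*-Solver)
  open +-*-Solver using (solve; _:+_; _:*_; _:=_; con)
  open import Function using (_∘_)
  open import Relation.Binary.PropositionalEquality

  -- cauchy f g n = Σ_{i+j=n} f i * g j
  cauchy : (ℕ → ℚ) → (ℕ → ℚ) → ℕ → ℚ
  cauchy f g zero    = f 0 * g 0
  cauchy f g (suc n) = f 0 * g (suc n) + cauchy (f ∘ suc) g n

  deriv : (ℕ → ℚ) → ℕ → ℚ
  deriv f i = ι (suc i) * f (suc i)

  cauchy-congˡ : ∀ {f f′} g n → (∀ i → f i ≡ f′ i) → cauchy f g n ≡ cauchy f′ g n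
  cauchy-congˡ g zero    f≗f′ = cong (_* g 0) (f≗f′ 0)
  cauchy-congˡ g (suc n) f≗f′ = cong₂ _+_ (cong (_* g (suc n)) (f≗f′ 0)) (cauchy-congˡ g n (f≗f′ ∘ suc))

  cauchy-congʳ : ∀ f {g g′} n → (∀ j → g j ≡ g′ j) → cauchy f g n ≡ cauchy f g′ n
  cauchy-congʳ f zero    g≗g′ = cong (f 0 *_) (g≗g′ 0)
  cauchy-congʳ f (suc n) g≗g′ = cong₂ _+_ (cong (f 0 *_) (g≗g′ (suc n))) (cauchy-congʳ (f ∘ suc) n g≗g′)

  cauchy-+ˡ : ∀ f h g n → cauchy (λ i → f i + h i) g n ≡ cauchy f g n + cauchy h g n
  cauchy-+ˡ f h g zero    = *-distribʳ-+ (g 0) (f 0) (h 0)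
  cauchy-+ˡ f h g (suc n) = begin
    (f 0 + h 0) * g (suc n) + cauchy (λ i → f (suc i) + h (suc i)) g n
      ≡⟨ cong ((f 0 + h 0) * g (suc n) +_) (cauchy-+ˡ (f ∘ suc) (h ∘ suc) g n) ⟩
    (f 0 + h 0) * g (suc n) + (cauchy (f ∘ suc) g n + cauchy (h ∘ suc) g n)
      ≡⟨ solve 5 (λ a b c p q → (a :+ b) :* c :+ (p :+ q) := (a :* c :+ p) :+ (b :* c :+ q)) refl
           (f 0) (h 0) (g (suc n)) (cauchy (f ∘ suc) g n) (cauchy (h ∘ suc) g n) ⟩
    cauchy f g (suc n) + cauchy h g (suc n) ∎
    where open ≡-Reasoning

  cauchy-*ˡ : ∀ c f g n → cauchy (λ i → c * f i) g n ≡ c * cauchy f g n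
  cauchy-*ˡ c f g zero    = *-assoc c (f 0) (g 0)
  cauchy-*ˡ c f g (suc n) = trans (cong₂ _+_ (*-assoc c (f 0) (g (suc n))) (cauchy-*ˡ c (f ∘ suc) g n))
                                  (sym (*-distribˡ-+ c (f 0 * g (suc n)) (cauchy (f ∘ suc) g n)))

  x*[c*y]≡c*[x*y] : ∀ x c y → x * (c * y) ≡ c * (x * y)
  x*[c*y]≡c*[x*y] = solve 3 (λ x c y → x :* (c :* y) := c :* (x :* y)) refl

  cauchy-*ʳ : ∀ c f g n → cauchy f (λ j → c * g j) n ≡ c * cauchy f g n
  cauchy-*ʳ c f g zero    = x*[c*y]≡c*[x*y] (f 0) c (g 0)
  cauchy-*ʳ c f g (suc n) =
    trans (cong₂ _+_ (x*[c*y]≡c*[x*y] (f 0) c (g (suc n))) (cauchy-*ʳ c (f ∘ suc) g n))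
          (sym (*-distribˡ-+ c (f 0 * g (suc n)) (cauchy (f ∘ suc) g n)))

  cauchy-nonNeg : ∀ {f g} n → (∀ i → 0ℚ ≤ f i) → (∀ j → 0ℚ ≤ g j) → 0ℚ ≤ cauchy f g n
  cauchy-nonNeg zero    f≥0 g≥0 = *-nonNeg (f≥0 0) (g≥0 0)
  cauchy-nonNeg (suc n) f≥0 g≥0 = +-mono-≤ (*-nonNeg (f≥0 0) (g≥0 (suc n))) (cauchy-nonNeg n (f≥0 ∘ suc) g≥0)

  cauchy-monoʳ-≤ : ∀ {f g g′} n → (∀ i → 0ℚ ≤ f i) → (∀ j → g j ≤ g′ j) → cauchy f g n ≤ cauchy f g′ n
  cauchy-monoʳ-≤ zero    f≥0 g≤g′ = *-monoˡ-≤ (f≥0 0) (g≤g′ 0)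
  cauchy-monoʳ-≤ (suc n) f≥0 g≤g′ = +-mono-≤ (*-monoˡ-≤ (f≥0 0) (g≤g′ (suc n))) (cauchy-monoʳ-≤ n (f≥0 ∘ suc) g≤g′)

  f₀*gₙ≤cauchy : ∀ {f g} n → (∀ i → 0ℚ ≤ f i) → (∀ j → 0ℚ ≤ g j) → f 0 * g n ≤ cauchy f g n
  f₀*gₙ≤cauchy zero    _   _   = ≤-refl
  f₀*gₙ≤cauchy (suc n) f≥0 g≥0 = p≤p+q (cauchy-nonNeg n (f≥0 ∘ suc) g≥0)

  cauchy-constʳ-suc : ∀ f c n → cauchy f (λ _ → c) (suc n) ≡ cauchy f (λ _ → c) n + f (suc n) * c
  cauchy-constʳ-suc f c zero    = refl
  cauchy-constʳ-suc f c (suc n) =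
    trans (cong (f 0 * c +_) (cauchy-constʳ-suc (f ∘ suc) c n)) (sym (+-assoc (f 0 * c) _ _))

  cauchy-runningSumʳ : ∀ f G g n → G 0 ≡ g 0 → (∀ j → G (suc j) ≡ G j + g (suc j)) →
                       cauchy f G (suc n) ≡ cauchy f G n + cauchy f g (suc n)
  cauchy-runningSumʳ f G g zero G₀≡g₀ G-suc = begin
    f 0 * G 1 + f 1 * G 0             ≡⟨ cong₂ (λ a b → f 0 * a + f 1 * b)
                                                (trans (G-suc 0) (cong (_+ g 1) G₀≡g₀)) G₀≡g₀ ⟩
    f 0 * (g 0 + g 1) + f 1 * g 0     ≡⟨ solve 4 (λ a b c d → a :* (c :+ d) :+ b :* c := a :* c :+ (a :* d :+ b :* c))
                                                refl (f 0) (f 1) (g 0) (g 1) ⟩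
    f 0 * g 0 + cauchy f g 1          ≡⟨ cong (λ z → f 0 * z + cauchy f g 1) (sym G₀≡g₀) ⟩
    f 0 * G 0 + cauchy f g 1          ∎
    where open ≡-Reasoning
  cauchy-runningSumʳ f G g (suc n) G₀≡g₀ G-suc = begin
    f 0 * G (suc (suc n)) + cauchy (f ∘ suc) G (suc n)
      ≡⟨ cong₂ _+_ (cong (f 0 *_) (G-suc (suc n))) (cauchy-runningSumʳ (f ∘ suc) G g n G₀≡g₀ G-suc) ⟩
    f 0 * (G (suc n) + g (suc (suc n))) + (cauchy (f ∘ suc) G n + cauchy (f ∘ suc) g (suc n))
      ≡⟨ solve 5 (λ a b c d e → a :* (b :+ c) :+ (d :+ e) := (a :* b :+ d) :+ (a :* c :+ e)) refl
           (f 0) (G (suc n)) (g (suc (suc n))) (cauchy (f ∘ suc) G n) (cauchy (f ∘ suc) g (suc n)) ⟩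
    cauchy f G (suc n) + cauchy f g (suc (suc n)) ∎
    where open ≡-Reasoning

  cauchy-weights : ∀ f g m →
    cauchy (λ i → ι i * f i) g m + cauchy f (λ j → ι j * g j) m ≡ ι m * cauchy f g m
  cauchy-weights f g zero =
    solve 2 (λ a b → (con 0ℚ :* a) :* b :+ a :* (con 0ℚ :* b) := con 0ℚ :* (a :* b)) refl (f 0) (g 0)
  cauchy-weights f g (suc m) = begin
    ι 0 * f 0 * g (suc m) + cauchy (λ i → ι (suc i) * f (suc i)) g m + (f 0 * (ι (suc m) * g (suc m)) + Q)
      ≡⟨ cong (λ z → ι 0 * f 0 * g (suc m) + z + (f 0 * (ι (suc m) * g (suc m)) + Q)) split ⟩
    ι 0 * f 0 * g (suc m) + (A + P) + (f 0 * (ι (suc m) * g (suc m)) + Q)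
      ≡⟨ solve 6 (λ f₀ g₁ i a p q → con 0ℚ :* f₀ :* g₁ :+ (a :+ p) :+ (f₀ :* ((con 1ℚ :+ i) :* g₁) :+ q)
                                  := (con 1ℚ :+ i) :* (f₀ :* g₁) :+ a :+ (p :+ q))
           refl (f 0) (g (suc m)) (ι m) A P Q ⟩
    ι (suc m) * (f 0 * g (suc m)) + A + (P + Q)
      ≡⟨ cong (ι (suc m) * (f 0 * g (suc m)) + A +_) (cauchy-weights (f ∘ suc) g m) ⟩
    ι (suc m) * (f 0 * g (suc m)) + A + ι m * A
      ≡⟨ solve 3 (λ i x a → (con 1ℚ :+ i) :* x :+ a :+ i :* a := (con 1ℚ :+ i) :* (x :+ a)) refl
           (ι m) (f 0 * g (suc m)) A ⟩
    ι (suc m) * cauchy f g (suc m) ∎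
    where
    open ≡-Reasoning
    A P Q : ℚ
    A = cauchy (f ∘ suc) g m
    P = cauchy (λ i → ι i * f (suc i)) g m
    Q = cauchy (f ∘ suc) (λ j → ι j * g j) m
    split : cauchy (λ i → ι (suc i) * f (suc i)) g m ≡ A + P
    split = trans (cauchy-congˡ g m (λ i → trans (*-distribʳ-+ (f (suc i)) 1ℚ (ι i))
                                                 (cong (_+ ι i * f (suc i)) (*-identityˡ (f (suc i))))))
                  (cauchy-+ˡ (f ∘ suc) (λ i → ι i * f (suc i)) g m)

  cauchy-shiftʳ : ∀ f g n → cauchy f (λ j → ι j * g j) (suc n) ≡ cauchy f (deriv g) n
  cauchy-shiftʳ f g zero    =
    trans (cong (f 0 * (ι 1 * g 1) +_) (solve 2 (λ a b → a :* (con 0ℚ :* b) := con 0ℚ) refl (f 1) (g 0)))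
          (+-identityʳ (f 0 * (ι 1 * g 1)))
  cauchy-shiftʳ f g (suc n) = cong (f 0 * deriv g (suc n) +_) (cauchy-shiftʳ (f ∘ suc) g n)

  cauchy-leibniz : ∀ f g n → ι (suc n) * cauchy f g (suc n) ≡ cauchy (deriv f) g n + cauchy f (deriv g) n
  cauchy-leibniz f g n = begin
    ι (suc n) * cauchy f g (suc n)
      ≡⟨ sym (cauchy-weights f g (suc n)) ⟩
    ι 0 * f 0 * g (suc n) + cauchy (deriv f) g n + cauchy f (λ j → ι j * g j) (suc n)
      ≡⟨ cong₂ _+_ (trans (cong (_+ cauchy (deriv f) g n) (0*a*b≡0 (f 0) (g (suc n))))
                          (+-identityˡ (cauchy (deriv f) g n)))
                   (cauchy-shiftʳ f g n) ⟩
    cauchy (deriv f) g n + cauchy f (deriv g) n ∎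
    where
    open ≡-Reasoning
    0*a*b≡0 : ∀ a b → 0ℚ * a * b ≡ 0ℚ
    0*a*b≡0 = solve 2 (λ a b → con 0ℚ :* a :* b := con 0ℚ) refl

module ExponentialSeries where
  open RationalArithmetic
  open CauchyProduct
  open import Defs using (expScaled; ExpLe)
  open import Data.Nat as ℕ using (ℕ; zero; suc; NonZero; _!)
  import Data.Nat.Properties as ℕ
  open import Data.Rational using (ℚ; 0ℚ; 1ℚ; _+_; _*_; _-_; 1/_; _≤_; _<_; positive; >-nonZero)
  open import Data.Rational.Properties
  open import Data.Rational.Solver using (module +-*-Solver)
  open +-*-Solver using (solve; _:+_; _:*_; _:-_; _:=_; con)
  open import Algebra.Bundles using (CommutativeRing)
  open import Algebra.Properties.CommutativeSemiring.Exp (CommutativeRing.commutativeSemiring +-*-commutativeRing)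
    using (_^_)
  open import Relation.Binary.PropositionalEquality

  dividedPower : ℕ → ℚ → ℚ
  dividedPower zero    x = 1ℚ
  dividedPower (suc j) x = (x * dividedPower j x) /ℕ suc j

  expPartial : ℕ → ℚ → ℚ
  expPartial zero    x = 1ℚ
  expPartial (suc J) x = expPartial J x + dividedPower (suc J) x

  ExpBound : ℚ → ℚ → Set
  ExpBound x V = ∀ J → expPartial J x ≤ V

  dividedPower-1 : ∀ x → dividedPower 1 x ≡ x
  dividedPower-1 x = trans (trans (sym (*-identityˡ ((x * 1ℚ) /ℕ 1))) (ιn*[p/ℕn]≡p (x * 1ℚ) 1)) (*-identityʳ x)

  dividedPower-nonNeg : ∀ j {x} → 0ℚ ≤ x → 0ℚ ≤ dividedPower j x
  dividedPower-nonNeg zero    _   = <⇒≤ 0<1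
  dividedPower-nonNeg (suc j) 0≤x = /ℕ-nonNeg (suc j) (*-nonNeg 0≤x (dividedPower-nonNeg j 0≤x))

  dividedPower-mono-≤ : ∀ j {x y} → 0ℚ ≤ x → x ≤ y → dividedPower j x ≤ dividedPower j y
  dividedPower-mono-≤ zero    _   _   = ≤-refl
  dividedPower-mono-≤ (suc j) 0≤x x≤y =
    /ℕ-monoˡ-≤ (suc j) (*-mono-≤ 0≤x (dividedPower-nonNeg j 0≤x) x≤y (dividedPower-mono-≤ j 0≤x x≤y))

  expPartial-mono-≤ : ∀ J {x y} → 0ℚ ≤ x → x ≤ y → expPartial J x ≤ expPartial J y
  expPartial-mono-≤ zero    _   _   = ≤-refl
  expPartial-mono-≤ (suc J) 0≤x x≤y = +-mono-≤ (expPartial-mono-≤ J 0≤x x≤y) (dividedPower-mono-≤ (suc J) 0≤x x≤y)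

  expPartial-≤-suc : ∀ J {x} → 0ℚ ≤ x → expPartial J x ≤ expPartial (suc J) x
  expPartial-≤-suc J 0≤x = p≤p+q (dividedPower-nonNeg (suc J) 0≤x)

  ι[n!]*dividedPower≡^ : ∀ n x → ι (n !) * dividedPower n x ≡ x ^ n
  ι[n!]*dividedPower≡^ zero    x = *-identityʳ (ι 1)
  ι[n!]*dividedPower≡^ (suc n) x = begin
    ι (suc n ℕ.* n !) * dividedPower (suc n) x       ≡⟨ cong (_* dividedPower (suc n) x) (ι-* (suc n) (n !)) ⟩
    ι (suc n) * ι (n !) * dividedPower (suc n) x     ≡⟨ solve 3 (λ a b c → a :* b :* c := b :* (a :* c)) refl
                                                                  (ι (suc n)) (ι (n !)) (dividedPower (suc n) x) ⟩
    ι (n !) * (ι (suc n) * dividedPower (suc n) x)   ≡⟨ cong (ι (n !) *_) (ιn*[p/ℕn]≡p (x * dividedPower n x) (suc n)) ⟩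
    ι (n !) * (x * dividedPower n x)                 ≡⟨ solve 3 (λ a b c → a :* (b :* c) := b :* (a :* c)) refl
                                                                  (ι (n !)) x (dividedPower n x) ⟩
    x * (ι (n !) * dividedPower n x)                 ≡⟨ cong (x *_) (ι[n!]*dividedPower≡^ n x) ⟩
    x ^ suc n                                        ∎
    where open ≡-Reasoning

  ι-expScaled : ∀ x J → ι (expScaled x J) ≡ ι (J !) * expPartial J (ι x)
  ι-expScaled x zero    = sym (*-identityʳ (ι 1))
  ι-expScaled x (suc J) = begin
    ι (suc J ℕ.* expScaled x J ℕ.+ x ℕ.^ suc J)
      ≡⟨ trans (ι-+ (suc J ℕ.* expScaled x J) (x ℕ.^ suc J))
               (cong₂ _+_ (ι-* (suc J) (expScaled x J)) (ι-^ x (suc J))) ⟩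
    ι (suc J) * ι (expScaled x J) + ι x ^ suc J
      ≡⟨ cong₂ (λ a b → ι (suc J) * a + b) (ι-expScaled x J) (sym (ι[n!]*dividedPower≡^ (suc J) (ι x))) ⟩
    ι (suc J) * (ι (J !) * S) + ι (suc J !) * dividedPower (suc J) (ι x)
      ≡⟨ cong (_+ ι (suc J !) * dividedPower (suc J) (ι x))
              (trans (sym (*-assoc (ι (suc J)) (ι (J !)) S)) (cong (_* S) (sym (ι-* (suc J) (J !))))) ⟩
    ι (suc J !) * S + ι (suc J !) * dividedPower (suc J) (ι x)
      ≡⟨ sym (*-distribˡ-+ (ι (suc J !)) S (dividedPower (suc J) (ι x))) ⟩
    ι (suc J !) * expPartial (suc J) (ι x) ∎
    where
    open ≡-Reasoning
    S : ℚ
    S = expPartial J (ι x)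

  ExpBound⇒ExpLe : ∀ x M → ExpBound (ι x) (ι M) → ExpLe x M
  ExpBound⇒ExpLe x M eˣ≤M J = ι-cancel-≤ (begin
    ι (expScaled x J)              ≡⟨ ι-expScaled x J ⟩
    ι (J !) * expPartial J (ι x)   ≤⟨ *-monoˡ-≤ (ι-nonNeg (J !)) (eˣ≤M J) ⟩
    ι (J !) * ι M                  ≡⟨ trans (*-comm (ι (J !)) (ι M)) (sym (ι-* M (J !))) ⟩
    ι (M ℕ.* J !)                  ∎)
    where open ≤-Reasoning

  dividedPower-+ : ∀ n x y → dividedPower n (x + y) ≡ cauchy (λ i → dividedPower i y) (λ j → dividedPower j x) n
  dividedPower-+ zero    x y = sym (*-identityˡ 1ℚ)
  dividedPower-+ (suc n) x y = ι-*-cancelˡ (suc n) (begin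
    ι (suc n) * dividedPower (suc n) (x + y)       ≡⟨ ιn*[p/ℕn]≡p ((x + y) * dividedPower n (x + y)) (suc n) ⟩
    (x + y) * dividedPower n (x + y)               ≡⟨ cong ((x + y) *_) (dividedPower-+ n x y) ⟩
    (x + y) * cauchy f g n                         ≡⟨ solve 3 (λ x y c → (x :+ y) :* c := y :* c :+ x :* c) refl x y (cauchy f g n) ⟩
    y * cauchy f g n + x * cauchy f g n            ≡⟨ sym (cong₂ _+_ (cauchy-*ˡ y f g n) (cauchy-*ʳ x f g n)) ⟩
    cauchy (λ i → y * f i) g n + cauchy f (λ j → x * g j) n
      ≡⟨ sym (cong₂ _+_ (cauchy-congˡ g n (λ i → ιn*[p/ℕn]≡p (y * f i) (suc i)))
                        (cauchy-congʳ f n (λ j → ιn*[p/ℕn]≡p (x * g j) (suc j)))) ⟩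
    cauchy (deriv f) g n + cauchy f (deriv g) n    ≡⟨ sym (cauchy-leibniz f g n) ⟩
    ι (suc n) * cauchy f g (suc n)                 ∎)
    where
    open ≡-Reasoning
    f g : ℕ → ℚ
    f i = dividedPower i y
    g j = dividedPower j x

  expPartial-+ : ∀ J x y → expPartial J (x + y) ≡ cauchy (λ i → dividedPower i y) (λ j → expPartial j x) J
  expPartial-+ zero    x y = sym (*-identityˡ 1ℚ)
  expPartial-+ (suc J) x y =
    trans (cong₂ _+_ (expPartial-+ J x y) (dividedPower-+ (suc J) x y))
          (sym (cauchy-runningSumʳ (λ i → dividedPower i y) (λ j → expPartial j x) (λ j → dividedPower j x)
                                   J refl (λ _ → refl)))

  cauchy-dividedPower-constʳ : ∀ J y c → cauchy (λ i → dividedPower i y) (λ _ → c) J ≡ expPartial J y * c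
  cauchy-dividedPower-constʳ zero    y c = refl
  cauchy-dividedPower-constʳ (suc J) y c =
    trans (cauchy-constʳ-suc (λ i → dividedPower i y) c J)
          (trans (cong (_+ dividedPower (suc J) y * c) (cauchy-dividedPower-constʳ J y c))
                 (sym (*-distribʳ-+ c (expPartial J y) (dividedPower (suc J) y))))

  ExpBound-+ : ∀ {x y V W} → 0ℚ ≤ x → 0ℚ ≤ y → ExpBound x V → ExpBound y W → ExpBound (x + y) (V * W)
  ExpBound-+ {x} {y} {V} {W} 0≤x 0≤y eˣ≤V eʸ≤W J = begin
    expPartial J (x + y)                                      ≡⟨ expPartial-+ J x y ⟩
    cauchy (λ i → dividedPower i y) (λ j → expPartial j x) J  ≤⟨ cauchy-monoʳ-≤ J (λ i → dividedPower-nonNeg i 0≤y) eˣ≤V ⟩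
    cauchy (λ i → dividedPower i y) (λ _ → V) J               ≡⟨ cauchy-dividedPower-constʳ J y V ⟩
    expPartial J y * V                                        ≤⟨ *-monoʳ-≤ (≤-trans (<⇒≤ 0<1) (eˣ≤V 0)) (eʸ≤W J) ⟩
    W * V                                                     ≡⟨ *-comm W V ⟩
    V * W                                                     ∎
    where open ≤-Reasoning

  ExpBound-0 : ExpBound 0ℚ 1ℚ
  ExpBound-0 zero    = ≤-refl
  ExpBound-0 (suc J) = ≤-trans (≤-reflexive (trans (cong (expPartial J 0ℚ +_) dividedPower-0) (+-identityʳ _))) (ExpBound-0 J)
    where
    dividedPower-0 : dividedPower (suc J) 0ℚ ≡ 0ℚ
    dividedPower-0 = trans (cong (_/ℕ suc J) (*-zeroˡ (dividedPower J 0ℚ))) (0/ℕn≡0 (suc J))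

  ExpBound-ι* : ∀ {x V} t → 0ℚ ≤ x → ExpBound x V → ExpBound (ι t * x) (V ^ t)
  ExpBound-ι* {x} zero    _   _    = subst (λ z → ExpBound z 1ℚ) (sym (*-zeroˡ x)) ExpBound-0
  ExpBound-ι* {x} (suc t) 0≤x eˣ≤V =
    subst (λ z → ExpBound z _) (sym (trans (*-distribʳ-+ x 1ℚ (ι t)) (cong (_+ ι t * x) (*-identityˡ x))))
          (ExpBound-+ 0≤x (*-nonNeg (ι-nonNeg t) 0≤x) eˣ≤V (ExpBound-ι* t 0≤x eˣ≤V))

  ExpBound-mono : ∀ {x y V W} → 0ℚ ≤ x → x ≤ y → V ≤ W → ExpBound y V → ExpBound x W
  ExpBound-mono 0≤x x≤y V≤W eʸ≤V J = ≤-trans (expPartial-mono-≤ J 0≤x x≤y) (≤-trans (eʸ≤V J) V≤W)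

  dividedPower[2u]≤2u^ : ∀ j {u} → 0ℚ ≤ u → dividedPower (suc j) (ι 2 * u) ≤ ι 2 * u ^ suc j
  dividedPower[2u]≤2u^ zero    {u} _   =
    ≤-reflexive (trans (dividedPower-1 (ι 2 * u)) (cong (ι 2 *_) (sym (*-identityʳ u))))
  dividedPower[2u]≤2u^ (suc j) {u} 0≤u = begin
    (ι 2 * u * dividedPower (suc j) (ι 2 * u)) /ℕ suc (suc j)
      ≤⟨ /ℕ-monoˡ-≤ (suc (suc j)) (*-monoˡ-≤ (*-nonNeg (ι-nonNeg 2) 0≤u) (dividedPower[2u]≤2u^ j 0≤u)) ⟩
    (ι 2 * u * (ι 2 * u ^ suc j)) /ℕ suc (suc j)
      ≡⟨ solve 4 (λ t u p i → t :* u :* (t :* p) :* i := (t :* (u :* p)) :* (t :* i)) refl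
           (ι 2) u (u ^ suc j) ((1/ ι (suc (suc j))) {{>-nonZero (ι-pos (suc (suc j)))}}) ⟩
    ι 2 * u ^ suc (suc j) * (ι 2 /ℕ suc (suc j))
      ≤⟨ *-monoˡ-≤ (*-nonNeg (ι-nonNeg 2) (^-nonNeg (suc (suc j)) 0≤u))
           (≤-trans (/ℕ-monoˡ-≤ (suc (suc j)) (ι-mono-≤ {2} {suc (suc j)} (ℕ.s≤s (ℕ.s≤s ℕ.z≤n))))
                    (≤-reflexive (ιn/ℕn≡1 (suc (suc j))))) ⟩
    ι 2 * u ^ suc (suc j) * 1ℚ
      ≡⟨ *-identityʳ _ ⟩
    ι 2 * u ^ suc (suc j) ∎
    where open ≤-Reasoning

  -- e^(2u) ≤ (1 + u)/(1 - u): the terms of e^(2u) are dominated by those of 1 + 2u + 2u² + ⋯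
  exp-padé : ∀ {u V} → 0ℚ ≤ u → 0ℚ < 1ℚ - u → 1ℚ + u ≤ V * (1ℚ - u) → ExpBound (ι 2 * u) V
  exp-padé {u} {V} 0≤u 0<1-u 1+u≤V[1-u] J = *-cancelˡ-≤-pos (1ℚ - u) {{positive 0<1-u}} (begin
    (1ℚ - u) * expPartial J (ι 2 * u)                    ≤⟨ p≤p+q (*-nonNeg (ι-nonNeg 2) (^-nonNeg (suc J) 0≤u)) ⟩
    (1ℚ - u) * expPartial J (ι 2 * u) + ι 2 * u ^ suc J  ≤⟨ invariant J ⟩
    1ℚ + u                                               ≤⟨ 1+u≤V[1-u] ⟩
    V * (1ℚ - u)                                         ≡⟨ *-comm V (1ℚ - u) ⟩
    (1ℚ - u) * V                                         ∎)
    where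
    open ≤-Reasoning
    invariant : ∀ J → (1ℚ - u) * expPartial J (ι 2 * u) + ι 2 * u ^ suc J ≤ 1ℚ + u
    invariant zero    = ≤-reflexive (solve 1 (λ u → (con 1ℚ :- u) :* con 1ℚ :+ (con 1ℚ :+ (con 1ℚ :+ con 0ℚ)) :* (u :* con 1ℚ)
                                                 := con 1ℚ :+ u) refl u)
    invariant (suc J) = begin
      (1ℚ - u) * (S + dividedPower (suc J) (ι 2 * u)) + ι 2 * u ^ suc (suc J)
        ≤⟨ +-monoˡ-≤ (ι 2 * u ^ suc (suc J)) (*-monoˡ-≤ (<⇒≤ 0<1-u) (+-monoʳ-≤ S (dividedPower[2u]≤2u^ J 0≤u))) ⟩
      (1ℚ - u) * (S + ι 2 * P) + ι 2 * (u * P)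
        ≡⟨ solve 4 (λ u s p t → (con 1ℚ :- u) :* (s :+ t :* p) :+ t :* (u :* p) := (con 1ℚ :- u) :* s :+ t :* p)
             refl u S P (ι 2) ⟩
      (1ℚ - u) * S + ι 2 * P
        ≤⟨ invariant J ⟩
      1ℚ + u ∎
      where
      S P : ℚ
      S = expPartial J (ι 2 * u)
      P = u ^ suc J

  exp-padé-÷ : ∀ a c b e .{{_ : NonZero c}} .{{_ : NonZero e}} .{{_ : NonZero (c ℕ.+ a)}} →
               e ℕ.* (c ℕ.+ 2 ℕ.* a) ℕ.≤ b ℕ.* c → ExpBound (ι 2 * (a ÷ (c ℕ.+ a))) (b ÷ e)
  exp-padé-÷ a c b e e[c+2a]≤bc =
    exp-padé (÷-nonNeg a n) (subst (0ℚ <_) (sym 1-u≡c÷n) (÷-pos c n))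
             (≤-by-clearing (*-pos (ι-pos n) (ι-pos e)) clear-1+u clear-V[1-u] e[c+2a]≤bc)
    where
    open ≡-Reasoning
    n : ℕ
    n = c ℕ.+ a
    u : ℚ
    u = a ÷ n
    1-u≡c÷n : 1ℚ - u ≡ c ÷ n
    1-u≡c÷n = ι-*-cancelˡ n (begin
      ι n * (1ℚ - u)     ≡⟨ solve 2 (λ n u → n :* (con 1ℚ :- u) := n :- n :* u) refl (ι n) u ⟩
      ι n - ι n * u      ≡⟨ cong₂ _-_ (ι-+ c a) (ιn*[p/ℕn]≡p (ι a) n) ⟩
      ι c + ι a - ι a    ≡⟨ solve 2 (λ c a → c :+ a :- a := c) refl (ι c) (ι a) ⟩
      ι c                ≡⟨ sym (ιn*[p/ℕn]≡p (ι c) n) ⟩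
      ι n * (c ÷ n)      ∎)
    clear-1+u : ι n * ι e * (1ℚ + u) ≡ ι (e ℕ.* (c ℕ.+ 2 ℕ.* a))
    clear-1+u = begin
      ι n * ι e * (1ℚ + u)          ≡⟨ solve 3 (λ n e u → n :* e :* (con 1ℚ :+ u) := e :* (n :+ n :* u)) refl (ι n) (ι e) u ⟩
      ι e * (ι n + ι n * u)         ≡⟨ cong (λ z → ι e * (ι n + z)) (ιn*[p/ℕn]≡p (ι a) n) ⟩
      ι e * (ι n + ι a)             ≡⟨ sym (trans (ι-* e (n ℕ.+ a)) (cong (ι e *_) (ι-+ n a))) ⟩
      ι (e ℕ.* (c ℕ.+ a ℕ.+ a))     ≡⟨ cong (λ z → ι (e ℕ.* z))
                                              (trans (ℕ.+-assoc c a a) (cong (λ z → c ℕ.+ (a ℕ.+ z)) (sym (ℕ.+-identityʳ a)))) ⟩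
      ι (e ℕ.* (c ℕ.+ 2 ℕ.* a))     ∎
    clear-V[1-u] : ι n * ι e * ((b ÷ e) * (1ℚ - u)) ≡ ι (b ℕ.* c)
    clear-V[1-u] = begin
      ι n * ι e * ((b ÷ e) * (1ℚ - u))          ≡⟨ cong (λ z → ι n * ι e * ((b ÷ e) * z)) 1-u≡c÷n ⟩
      ι n * ι e * ((b ÷ e) * (c ÷ n))           ≡⟨ solve 4 (λ n e p q → n :* e :* (p :* q) := (e :* p) :* (n :* q)) refl
                                                            (ι n) (ι e) (b ÷ e) (c ÷ n) ⟩
      (ι e * (b ÷ e)) * (ι n * (c ÷ n))         ≡⟨ cong₂ _*_ (ιn*[p/ℕn]≡p (ι b) e) (ιn*[p/ℕn]≡p (ι c) n) ⟩
      ι b * ι c                                 ≡⟨ sym (ι-* b c) ⟩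
      ι (b ℕ.* c)                               ∎

  dividedPower-suc-+ : ∀ n {x w} → 0ℚ ≤ x → 0ℚ ≤ w →
                       dividedPower (suc n) x + w * dividedPower n x ≤ dividedPower (suc n) (x + w)
  dividedPower-suc-+ n {x} {w} 0≤x 0≤w = begin
    dividedPower (suc n) x + w * dividedPower n x
      ≡⟨ cong₂ _+_ (sym (*-identityˡ (dividedPower (suc n) x))) (cong (_* dividedPower n x) (sym (dividedPower-1 w))) ⟩
    dividedPower 0 w * dividedPower (suc n) x + dividedPower 1 w * dividedPower n x
      ≤⟨ +-monoʳ-≤ (dividedPower 0 w * dividedPower (suc n) x)
           (f₀*gₙ≤cauchy {λ i → dividedPower (suc i) w} {λ j → dividedPower j x} n
                         (λ i → dividedPower-nonNeg (suc i) 0≤w) (λ j → dividedPower-nonNeg j 0≤x)) ⟩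
    cauchy (λ i → dividedPower i w) (λ j → dividedPower j x) (suc n)
      ≡⟨ sym (dividedPower-+ (suc n) x w) ⟩
    dividedPower (suc n) (x + w) ∎
    where open ≤-Reasoning

  expPartial-suc-+ : ∀ J {x w} → 0ℚ ≤ x → 0ℚ ≤ w →
                     expPartial (suc J) x + w * expPartial J x ≤ expPartial (suc J) (x + w)
  expPartial-suc-+ zero {x} {w} 0≤x 0≤w = begin
    (1ℚ + dividedPower 1 x) + w * 1ℚ     ≡⟨ +-assoc 1ℚ (dividedPower 1 x) (w * 1ℚ) ⟩
    1ℚ + (dividedPower 1 x + w * 1ℚ)     ≤⟨ +-monoʳ-≤ 1ℚ (dividedPower-suc-+ 0 0≤x 0≤w) ⟩
    1ℚ + dividedPower 1 (x + w)          ∎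
    where open ≤-Reasoning
  expPartial-suc-+ (suc J) {x} {w} 0≤x 0≤w = begin
    (expPartial (suc J) x + dividedPower (suc (suc J)) x) + w * (expPartial J x + dividedPower (suc J) x)
      ≡⟨ solve 5 (λ a b c d w → (a :+ b) :+ w :* (c :+ d) := (a :+ w :* c) :+ (b :+ w :* d)) refl
           (expPartial (suc J) x) (dividedPower (suc (suc J)) x) (expPartial J x) (dividedPower (suc J) x) w ⟩
    (expPartial (suc J) x + w * expPartial J x) + (dividedPower (suc (suc J)) x + w * dividedPower (suc J) x)
      ≤⟨ +-mono-≤ (expPartial-suc-+ J 0≤x 0≤w) (dividedPower-suc-+ (suc J) 0≤x 0≤w) ⟩
    expPartial (suc J) (x + w) + dividedPower (suc (suc J)) (x + w) ∎
    where open ≤-Reasoning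

  expPartial*[1+w]≤expPartial-suc : ∀ J {x w} → 0ℚ ≤ x → 0ℚ ≤ w → expPartial J x * (1ℚ + w) ≤ expPartial (suc J) (x + w)
  expPartial*[1+w]≤expPartial-suc J {x} {w} 0≤x 0≤w = begin
    expPartial J x * (1ℚ + w)                   ≡⟨ solve 2 (λ s w → s :* (con 1ℚ :+ w) := s :+ w :* s) refl (expPartial J x) w ⟩
    expPartial J x + w * expPartial J x         ≤⟨ +-monoˡ-≤ (w * expPartial J x) (expPartial-≤-suc J 0≤x) ⟩
    expPartial (suc J) x + w * expPartial J x   ≤⟨ expPartial-suc-+ J 0≤x 0≤w ⟩
    expPartial (suc J) (x + w)                  ∎
    where open ≤-Reasoning

  expPartial*[1+w]^T≤ : ∀ T J {x w} → 0ℚ ≤ x → 0ℚ ≤ w →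
                        expPartial J x * (1ℚ + w) ^ T ≤ expPartial (T ℕ.+ J) (x + ι T * w)
  expPartial*[1+w]^T≤ zero    J {x} {w} _   _   =
    ≤-reflexive (trans (*-identityʳ _) (cong (expPartial J) (sym (trans (cong (x +_) (*-zeroˡ w)) (+-identityʳ x)))))
  expPartial*[1+w]^T≤ (suc T) J {x} {w} 0≤x 0≤w = begin
    expPartial J x * ((1ℚ + w) * (1ℚ + w) ^ T)
      ≡⟨ solve 3 (λ s a p → s :* (a :* p) := (s :* p) :* a) refl (expPartial J x) (1ℚ + w) ((1ℚ + w) ^ T) ⟩
    expPartial J x * (1ℚ + w) ^ T * (1ℚ + w)
      ≤⟨ *-monoʳ-≤ (+-mono-≤ (<⇒≤ 0<1) 0≤w) (expPartial*[1+w]^T≤ T J 0≤x 0≤w) ⟩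
    expPartial (T ℕ.+ J) (x + ι T * w) * (1ℚ + w)
      ≤⟨ expPartial*[1+w]≤expPartial-suc (T ℕ.+ J) (+-mono-≤ 0≤x (*-nonNeg (ι-nonNeg T) 0≤w)) 0≤w ⟩
    expPartial (suc T ℕ.+ J) (x + ι T * w + w)
      ≡⟨ cong (expPartial (suc T ℕ.+ J))
              (solve 3 (λ x t w → x :+ t :* w :+ w := x :+ (con 1ℚ :+ t) :* w) refl x (ι T) w) ⟩
    expPartial (suc T ℕ.+ J) (x + ι (suc T) * w) ∎
    where open ≤-Reasoning


-- The window d < N < 2d of the lower bound, parametrised by k = 2d - N = r + 1 and
-- t = N - d = s + 1; m = 4(d - 1) is the exponent of the theorem.
module StarParameters (r s : ℕ) where
  open import Data.Nat
  open import Data.Nat.Properties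
  open import Data.Nat.Tactic.RingSolver using (solve-∀)
  open import Relation.Binary.PropositionalEquality

  k t d N m 2d Q E k² N² : ℕ
  k  = suc r
  t  = suc s
  d  = k + t
  N  = k + 2 * t
  m  = 4 * (r + t)
  2d = 2 * d
  Q  = 2d * (2 * t)
  E  = 2 * N + k
  k² = k * k
  N² = N * N

  PotentialBound : Set
  PotentialBound = (N + k) ^ d * (N ∸ k) ^ (N ∸ d) ≤ N ^ (N ∸ 1) * (N² + 2 * k)

  N[2N+2k]≡2d*2N : N * (2 * N + 2 * k) ≡ 2d * (2 * N)
  N[2N+2k]≡2d*2N = lemma k t
    where
    lemma : ∀ k t → let d = k + t; N = k + 2 * t in N * (2 * N + 2 * k) ≡ 2 * d * (2 * N)
    lemma = solve-∀

  Q+k²≡N² : Q + k² ≡ N²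
  Q+k²≡N² = lemma k t
    where
    lemma : ∀ k t → let d = k + t; N = k + 2 * t in 2 * d * (2 * t) + k * k ≡ N * N
    lemma = solve-∀

  3[N²+2k]≤8dN : 3 * (N² + 2 * k) ≤ 8 * d * N
  3[N²+2k]≤8dN = subst (3 * (N² + 2 * k) ≤_) (sym (lemma r s)) (m≤m+n _ _)
    where
    lemma : ∀ r s → let k = suc r; t = suc s; d = k + t; N = k + 2 * t in
      8 * d * N ≡ 3 * (N * N + 2 * k) + (15 + 20 * s + 4 * s * s + 16 * r + 12 * r * s + 5 * r * r)
    lemma = solve-∀

  ^-distribʳ-* : ∀ a b n → (a * b) ^ n ≡ a ^ n * b ^ n
  ^-distribʳ-* a b zero    = refl
  ^-distribʳ-* a b (suc n) = trans (cong (a * b *_) (^-distribʳ-* a b n)) (lemma a b (a ^ n) (b ^ n))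
    where
    lemma : ∀ a b x y → a * b * (x * y) ≡ a * x * (b * y)
    lemma = solve-∀

  N^N≡N^k*N²^t : N ^ N ≡ N ^ k * N² ^ t
  N^N≡N^k*N²^t = begin
    N ^ (k + 2 * t)        ≡⟨ ^-distribˡ-+-* N k (2 * t) ⟩
    N ^ k * N ^ (2 * t)    ≡⟨ cong (N ^ k *_) (sym (^-*-assoc N 2 t)) ⟩
    N ^ k * (N ^ 2) ^ t    ≡⟨ cong (λ z → N ^ k * (N * z) ^ t) (*-identityʳ N) ⟩
    N ^ k * N² ^ t         ∎
    where open ≡-Reasoning

  2d^k*Q^t≡2d^d*[2t]^t : 2d ^ k * Q ^ t ≡ 2d ^ d * (2 * t) ^ t
  2d^k*Q^t≡2d^d*[2t]^t = begin
    2d ^ k * (2d * (2 * t)) ^ t        ≡⟨ cong (2d ^ k *_) (^-distribʳ-* 2d (2 * t) t) ⟩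
    2d ^ k * (2d ^ t * (2 * t) ^ t)    ≡⟨ sym (*-assoc (2d ^ k) (2d ^ t) ((2 * t) ^ t)) ⟩
    2d ^ k * 2d ^ t * (2 * t) ^ t      ≡⟨ cong (_* (2 * t) ^ t) (sym (^-distribˡ-+-* 2d k t)) ⟩
    2d ^ d * (2 * t) ^ t               ∎
    where open ≡-Reasoning

  potential-bound-simplified : PotentialBound → 3 * (2d ^ k * Q ^ t) ≤ 8 * d * (N ^ k * N² ^ t)
  potential-bound-simplified potential = begin
    3 * (2d ^ k * Q ^ t)                ≡⟨ cong (3 *_) 2d^k*Q^t≡2d^d*[2t]^t ⟩
    3 * (2d ^ d * (2 * t) ^ t)          ≤⟨ *-monoʳ-≤ 3 (subst₂ (λ a b → a ^ d * b ≤ N ^ (r + 2 * t) * (N² + 2 * k))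
                                                              N+k≡2d [N∸k]^[N∸d]≡[2t]^t potential) ⟩
    3 * (N ^ (r + 2 * t) * (N² + 2 * k))  ≡⟨ x*[y*z]≡y*[x*z] 3 (N ^ (r + 2 * t)) (N² + 2 * k) ⟩
    N ^ (r + 2 * t) * (3 * (N² + 2 * k))  ≤⟨ *-monoʳ-≤ (N ^ (r + 2 * t)) 3[N²+2k]≤8dN ⟩
    N ^ (r + 2 * t) * (8 * d * N)         ≡⟨ trans (x*[y*z]≡y*[x*z] (N ^ (r + 2 * t)) (8 * d) N)
                                                   (cong (8 * d *_) (*-comm (N ^ (r + 2 * t)) N)) ⟩
    8 * d * N ^ N                         ≡⟨ cong (8 * d *_) N^N≡N^k*N²^t ⟩
    8 * d * (N ^ k * N² ^ t)              ∎
    where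
    open ≤-Reasoning
    x*[y*z]≡y*[x*z] : ∀ x y z → x * (y * z) ≡ y * (x * z)
    x*[y*z]≡y*[x*z] = solve-∀
    N+k≡2d : N + k ≡ 2d
    N+k≡2d = lemma k t
      where
      lemma : ∀ k t → (k + 2 * t) + k ≡ 2 * (k + t)
      lemma = solve-∀
    [N∸k]^[N∸d]≡[2t]^t : (N ∸ k) ^ (N ∸ d) ≡ (2 * t) ^ t
    [N∸k]^[N∸d]≡[2t]^t = cong₂ _^_ (m+n∸m≡n k (2 * t)) (trans (cong (_∸ d) (lemma k t)) (m+n∸m≡n d t))
      where
      lemma : ∀ k t → k + 2 * t ≡ (k + t) + t
      lemma = solve-∀

  -- exponent-bound below, multiplied out by its denominators Q, E and 5
  exponent-comparison : E * 5 * (Q * k² + t * m * k²) ≤ m * 2 * Q * (5 * k² + E)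
  exponent-comparison = subst (E * 5 * (Q * k² + t * m * k²) ≤_) (sym (lemma r s)) (m≤m+n _ _)
    where
    lemma : ∀ r s → let k = suc r; t = suc s; d = k + t; N = k + 2 * t; m = 4 * (r + t)
                        Q = 2 * d * (2 * t); E = 2 * N + k in
      m * 2 * Q * (5 * (k * k) + E) ≡ E * 5 * (Q * (k * k) + t * m * (k * k))
        + 4 * t * (87 + 222 * s + 152 * s * s + 32 * s * s * s + 171 * r + 270 * r * s + 88 * r * s * s
                   + 123 * r * r + 90 * r * r * s + 49 * r * r * r + 10 * r * r * r * s + 10 * r * r * r * r)
    lemma = solve-∀

-- With x = (N + k)/N, u = k/(2N + k) and 1 + w = N²/((N + k)(N - k)) one has
-- e^(2u) ≤ (1 + u)/(1 - u) = x, and the potential bound becomes x^k ≤ (1 + w)^t (N² + 2k)/N.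
module StarExponent (r s : ℕ) (potential : StarParameters.PotentialBound r s) where
  open RationalArithmetic
  open ExponentialSeries
  open StarParameters r s
  open import Defs using (ExpLe)
  open import Data.Nat as ℕ using (ℕ)
  import Data.Nat.Properties as ℕ
  open import Data.Rational using (ℚ; 0ℚ; 1ℚ; _+_; _*_; _≤_; _<_; positive)
  open import Data.Rational.Properties
    using (≤-trans; ≤-reflexive; ≤-refl; +-mono-≤; *-cancelʳ-≤-pos; *-assoc; *-identityʳ; +-identityʳ; +-*-commutativeRing)
  open import Data.Rational.Solver using (module +-*-Solver)
  open +-*-Solver using (solve; _:+_; _:*_; _:=_)
  open import Algebra.Bundles using (CommutativeRing)
  open import Algebra.Properties.CommutativeSemiring.Exp (CommutativeRing.commutativeSemiring +-*-commutativeRing)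
    using (_^_; ^-assocʳ; ^-distrib-*)
  open import Relation.Binary.PropositionalEquality

  x u w : ℚ
  x = 2d ÷ N
  u = k ÷ E
  w = k² ÷ Q

  1+w≡N²/Q : 1ℚ + w ≡ N² ÷ Q
  1+w≡N²/Q = trans (1+[a÷n]≡[n+a]÷n k² Q) (cong (_÷ Q) Q+k²≡N²)

  e^[2u]≤x : ExpBound (ι 2 * u) x
  e^[2u]≤x = exp-padé-÷ k (2 ℕ.* N) 2d N (ℕ.≤-reflexive N[2N+2k]≡2d*2N)

  e^[2/5]≤3/2 : ExpBound (ι 2 * (1 ÷ 5)) (3 ÷ 2)
  e^[2/5]≤3/2 = exp-padé-÷ 1 4 3 2 ℕ.≤-refl

  x^k*3/2≤4d*[1+w]^t : x ^ k * (3 ÷ 2) ≤ ι (4 ℕ.* d) * (1ℚ + w) ^ t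
  x^k*3/2≤4d*[1+w]^t = ≤-by-clearing 0<c clear-lhs clear-rhs
    (subst (3 ℕ.* ((2d ℕ.^ k) ℕ.* Q ℕ.^ t) ℕ.≤_) (cong (ℕ._* (N ℕ.^ k ℕ.* N² ℕ.^ t)) (ℕ.*-assoc 2 4 d))
           (potential-bound-simplified potential))
    where
    open ≡-Reasoning
    c : ℚ
    c = ι 2 * (ι (N ℕ.^ k) * ι (Q ℕ.^ t))
    0<c : 0ℚ < c
    0<c = *-pos (ι-pos 2) (*-pos (ι-pos (N ℕ.^ k) {{ℕ.m^n≢0 N k}}) (ι-pos (Q ℕ.^ t) {{ℕ.m^n≢0 Q t}}))
    clear-lhs : c * (x ^ k * (3 ÷ 2)) ≡ ι (3 ℕ.* (2d ℕ.^ k ℕ.* Q ℕ.^ t))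
    clear-lhs = begin
      ι 2 * (ι (N ℕ.^ k) * ι (Q ℕ.^ t)) * (x ^ k * (3 ÷ 2))
        ≡⟨ solve 5 (λ a b c p q → a :* (b :* c) :* (p :* q) := (a :* q) :* ((p :* b) :* c)) refl
             (ι 2) (ι (N ℕ.^ k)) (ι (Q ℕ.^ t)) (x ^ k) (3 ÷ 2) ⟩
      (ι 2 * (3 ÷ 2)) * ((x ^ k * ι (N ℕ.^ k)) * ι (Q ℕ.^ t))
        ≡⟨ cong₂ (λ a b → a * (b * ι (Q ℕ.^ t))) (ιn*[p/ℕn]≡p (ι 3) 2) ([a÷n]^j*ι[n^j]≡ι[a^j] 2d N k) ⟩
      ι 3 * (ι (2d ℕ.^ k) * ι (Q ℕ.^ t))
        ≡⟨ sym (trans (ι-* 3 (2d ℕ.^ k ℕ.* Q ℕ.^ t)) (cong (ι 3 *_) (ι-* (2d ℕ.^ k) (Q ℕ.^ t)))) ⟩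
      ι (3 ℕ.* (2d ℕ.^ k ℕ.* Q ℕ.^ t)) ∎
    clear-rhs : c * (ι (4 ℕ.* d) * (1ℚ + w) ^ t) ≡ ι (2 ℕ.* (4 ℕ.* d) ℕ.* (N ℕ.^ k ℕ.* N² ℕ.^ t))
    clear-rhs = begin
      ι 2 * (ι (N ℕ.^ k) * ι (Q ℕ.^ t)) * (ι (4 ℕ.* d) * (1ℚ + w) ^ t)
        ≡⟨ solve 5 (λ a b c p q → a :* (b :* c) :* (p :* q) := (a :* p) :* (b :* (q :* c))) refl
             (ι 2) (ι (N ℕ.^ k)) (ι (Q ℕ.^ t)) (ι (4 ℕ.* d)) ((1ℚ + w) ^ t) ⟩
      (ι 2 * ι (4 ℕ.* d)) * (ι (N ℕ.^ k) * ((1ℚ + w) ^ t * ι (Q ℕ.^ t)))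
        ≡⟨ cong (λ z → (ι 2 * ι (4 ℕ.* d)) * (ι (N ℕ.^ k) * (z ^ t * ι (Q ℕ.^ t)))) 1+w≡N²/Q ⟩
      (ι 2 * ι (4 ℕ.* d)) * (ι (N ℕ.^ k) * ((N² ÷ Q) ^ t * ι (Q ℕ.^ t)))
        ≡⟨ cong (λ z → (ι 2 * ι (4 ℕ.* d)) * (ι (N ℕ.^ k) * z)) ([a÷n]^j*ι[n^j]≡ι[a^j] N² Q t) ⟩
      (ι 2 * ι (4 ℕ.* d)) * (ι (N ℕ.^ k) * ι (N² ℕ.^ t))
        ≡⟨ sym (trans (ι-* (2 ℕ.* (4 ℕ.* d)) (N ℕ.^ k ℕ.* N² ℕ.^ t))
                      (cong₂ _*_ (ι-* 2 (4 ℕ.* d)) (ι-* (N ℕ.^ k) (N² ℕ.^ t)))) ⟩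
      ι (2 ℕ.* (4 ℕ.* d) ℕ.* (N ℕ.^ k ℕ.* N² ℕ.^ t)) ∎

  exponent-bound : ι k² + ι (t ℕ.* m) * w ≤ ι m * (ι k * (ι 2 * u) + ι 2 * (1 ÷ 5))
  exponent-bound = ≤-by-clearing (*-pos (*-pos (ι-pos Q) (ι-pos E)) (ι-pos 5)) clear-lhs clear-rhs exponent-comparison
    where
    open ≡-Reasoning
    clear-lhs : ι Q * ι E * ι 5 * (ι k² + ι (t ℕ.* m) * w) ≡ ι (E ℕ.* 5 ℕ.* (Q ℕ.* k² ℕ.+ t ℕ.* m ℕ.* k²))
    clear-lhs = begin
      ι Q * ι E * ι 5 * (ι k² + ι (t ℕ.* m) * w)
        ≡⟨ solve 6 (λ q e f a b w → q :* e :* f :* (a :+ b :* w) := e :* f :* (q :* a :+ b :* (q :* w))) refl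
             (ι Q) (ι E) (ι 5) (ι k²) (ι (t ℕ.* m)) w ⟩
      ι E * ι 5 * (ι Q * ι k² + ι (t ℕ.* m) * (ι Q * w))
        ≡⟨ cong (λ z → ι E * ι 5 * (ι Q * ι k² + ι (t ℕ.* m) * z)) (ιn*[p/ℕn]≡p (ι k²) Q) ⟩
      ι E * ι 5 * (ι Q * ι k² + ι (t ℕ.* m) * ι k²)
        ≡⟨ sym (trans (ι-* (E ℕ.* 5) (Q ℕ.* k² ℕ.+ t ℕ.* m ℕ.* k²))
                      (cong₂ _*_ (ι-* E 5) (trans (ι-+ (Q ℕ.* k²) (t ℕ.* m ℕ.* k²))
                                                  (cong₂ _+_ (ι-* Q k²) (ι-* (t ℕ.* m) k²))))) ⟩
      ι (E ℕ.* 5 ℕ.* (Q ℕ.* k² ℕ.+ t ℕ.* m ℕ.* k²)) ∎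
    clear-rhs : ι Q * ι E * ι 5 * (ι m * (ι k * (ι 2 * u) + ι 2 * (1 ÷ 5))) ≡ ι (m ℕ.* 2 ℕ.* Q ℕ.* (5 ℕ.* k² ℕ.+ E))
    clear-rhs = begin
      ι Q * ι E * ι 5 * (ι m * (ι k * (ι 2 * u) + ι 2 * (1 ÷ 5)))
        ≡⟨ solve 8 (λ q e f m k t u v → q :* e :* f :* (m :* (k :* (t :* u) :+ t :* v))
                                      := m :* t :* q :* (f :* k :* (e :* u) :+ e :* (f :* v)))
             refl (ι Q) (ι E) (ι 5) (ι m) (ι k) (ι 2) u (1 ÷ 5) ⟩
      ι m * ι 2 * ι Q * (ι 5 * ι k * (ι E * u) + ι E * (ι 5 * (1 ÷ 5)))
        ≡⟨ cong₂ (λ a b → ι m * ι 2 * ι Q * (ι 5 * ι k * a + ι E * b)) (ιn*[p/ℕn]≡p (ι k) E) (ιn*[p/ℕn]≡p (ι 1) 5) ⟩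
      ι m * ι 2 * ι Q * (ι 5 * ι k * ι k + ι E * ι 1)
        ≡⟨ cong (ι m * ι 2 * ι Q *_) (cong₂ _+_ (*-assoc (ι 5) (ι k) (ι k))
                                                (trans (cong (ι E *_) (+-identityʳ 1ℚ)) (*-identityʳ (ι E)))) ⟩
      ι m * ι 2 * ι Q * (ι 5 * (ι k * ι k) + ι E)
        ≡⟨ sym (trans (ι-* (m ℕ.* 2 ℕ.* Q) (5 ℕ.* k² ℕ.+ E))
                      (cong₂ _*_ (ι-*³ m 2 Q) (trans (ι-+ (5 ℕ.* k²) E)
                                                     (cong (_+ ι E) (trans (ι-* 5 k²) (cong (ι 5 *_) (ι-* k k))))))) ⟩
      ι (m ℕ.* 2 ℕ.* Q ℕ.* (5 ℕ.* k² ℕ.+ E)) ∎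

  0≤2u : 0ℚ ≤ ι 2 * u
  0≤2u = *-nonNeg (ι-nonNeg 2) (÷-nonNeg k E)

  0≤2/5 : 0ℚ ≤ ι 2 * (1 ÷ 5)
  0≤2/5 = *-nonNeg (ι-nonNeg 2) (÷-nonNeg 1 5)

  y : ℚ
  y = ι k * (ι 2 * u) + ι 2 * (1 ÷ 5)

  0≤y : 0ℚ ≤ y
  0≤y = +-mono-≤ (*-nonNeg (ι-nonNeg k) 0≤2u) 0≤2/5

  e^y≤4d*[1+w]^t : ExpBound y (ι (4 ℕ.* d) * (1ℚ + w) ^ t)
  e^y≤4d*[1+w]^t = ExpBound-mono 0≤y ≤-refl x^k*3/2≤4d*[1+w]^t
    (ExpBound-+ (*-nonNeg (ι-nonNeg k) 0≤2u) 0≤2/5 (ExpBound-ι* k 0≤2u e^[2u]≤x) e^[2/5]≤3/2)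

  [4d*[1+w]^t]^m≡ : (ι (4 ℕ.* d) * (1ℚ + w) ^ t) ^ m ≡ ι ((4 ℕ.* d) ℕ.^ m) * (1ℚ + w) ^ (t ℕ.* m)
  [4d*[1+w]^t]^m≡ = trans (^-distrib-* (ι (4 ℕ.* d)) ((1ℚ + w) ^ t) m)
                          (cong₂ _*_ (sym (ι-^ (4 ℕ.* d) m)) (^-assocʳ (1ℚ + w) t m))

  e^[k²+tmw]≤[4d]^m*[1+w]^tm : ExpBound (ι k² + ι (t ℕ.* m) * w) (ι ((4 ℕ.* d) ℕ.^ m) * (1ℚ + w) ^ (t ℕ.* m))
  e^[k²+tmw]≤[4d]^m*[1+w]^tm =
    ExpBound-mono (+-mono-≤ (ι-nonNeg k²) (*-nonNeg (ι-nonNeg (t ℕ.* m)) (÷-nonNeg k² Q)))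
                  exponent-bound (≤-reflexive [4d*[1+w]^t]^m≡) (ExpBound-ι* m 0≤y e^y≤4d*[1+w]^t)

  e^[k²]≤[4d]^m : ExpLe k² ((4 ℕ.* d) ℕ.^ m)
  e^[k²]≤[4d]^m = ExpBound⇒ExpLe k² ((4 ℕ.* d) ℕ.^ m) λ J →
    *-cancelʳ-≤-pos ((1ℚ + w) ^ (t ℕ.* m)) {{positive (^-pos (t ℕ.* m) 0<1+w)}}
      (≤-trans (expPartial*[1+w]^T≤ (t ℕ.* m) J (ι-nonNeg k²) (÷-nonNeg k² Q))
               (e^[k²+tmw]≤[4d]^m*[1+w]^tm (t ℕ.* m ℕ.+ J)))
    where
    0<1+w : 0ℚ < 1ℚ + w
    0<1+w = subst (0ℚ <_) (sym 1+w≡N²/Q) (÷-pos N² Q)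

module UpdateSum {c ℓ} (M : CommutativeMonoid c ℓ) where
  open CommutativeMonoid M
  open import Algebra.Properties.CommutativeMonoid.Sum M using (sum; sum-remove; sum-cong-≋)
  open import Algebra.Solver.CommutativeMonoid M using (solve; _⊕_; _⊜_)
  open import Data.Fin using (punchIn)
  open import Data.Nat using (suc)
  import Data.Fin.Properties as Fin
  open import Data.Vec.Functional using (Vector; removeAt)
  open import Relation.Binary.PropositionalEquality using (_≢_)
  open import Relation.Binary.Reasoning.Setoid setoid

  sum-update : ∀ {n} (t t′ : Vector Carrier (suc n)) i → (∀ j → j ≢ i → t′ j ≈ t j) →
               sum t′ ∙ t i ≈ sum t ∙ t′ i
  sum-update t t′ i t′≈t = begin
    sum t′ ∙ t i                               ≈⟨ ∙-congʳ (sum-remove t′) ⟩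
    (t′ i ∙ sum (removeAt t′ i)) ∙ t i         ≈⟨ ∙-congʳ (∙-congˡ (sum-cong-≋ (λ j → t′≈t (punchIn i j) (Fin.punchInᵢ≢i i j)))) ⟩
    (t′ i ∙ sum (removeAt t i)) ∙ t i          ≈⟨ solve 3 (λ a s b → (a ⊕ s) ⊕ b ⊜ (b ⊕ s) ⊕ a) refl (t′ i) (sum (removeAt t i)) (t i) ⟩
    (t i ∙ sum (removeAt t i)) ∙ t′ i          ≈⟨ ∙-congʳ (sym (sum-remove t)) ⟩
    sum t ∙ t′ i                               ∎

module NatSums where
  open import Data.Nat hiding (_≟_)
  open import Data.Nat.Properties
  open import Data.Nat.Tactic.RingSolver using (solve-∀)
  open import Data.Fin using (Fin; zero; suc; punchIn; punchOut)
  import Data.Fin.Properties as Fin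
  open import Data.Vec.Functional using (Vector; removeAt)
  import Algebra.Properties.CommutativeMonoid.Sum as CommutativeMonoidSum
  import Algebra.Properties.Semiring.Sum as SemiringSum
  open import Function using (_∘_)
  open import Function.Definitions using (Injective)
  open import Relation.Binary.PropositionalEquality
  open import Relation.Nullary using (yes; no; contradiction)

  private
    module Σ = CommutativeMonoidSum +-0-commutativeMonoid
    module Π = CommutativeMonoidSum *-1-commutativeMonoid

  sum product : ∀ {n} → Vector ℕ n → ℕ
  sum     = Σ.sum
  product = Π.sum

  sum-cong : ∀ {n} {t t′ : Vector ℕ n} → (∀ i → t i ≡ t′ i) → sum t ≡ sum t′
  sum-cong = Σ.sum-cong-≋

  product-cong : ∀ {n} {t t′ : Vector ℕ n} → (∀ i → t i ≡ t′ i) → product t ≡ product t′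
  product-cong = Π.sum-cong-≋

  *-distribˡ-sum : ∀ {n} c (t : Vector ℕ n) → c * sum t ≡ sum (λ i → c * t i)
  *-distribˡ-sum = SemiringSum.*-distribˡ-sum +-*-semiring

  sum-const : ∀ n c → sum {n} (λ _ → c) ≡ n * c
  sum-const zero    c = refl
  sum-const (suc n) c = cong (c +_) (sum-const n c)

  product-const : ∀ n c → product {n} (λ _ → c) ≡ c ^ n
  product-const zero    c = refl
  product-const (suc n) c = cong (c *_) (product-const n c)

  ≤-sum : ∀ {n} (t : Vector ℕ n) i → t i ≤ sum t
  ≤-sum {suc n} t i = ≤-trans (m≤m+n (t i) _) (≤-reflexive (sym (Σ.sum-remove {i = i} t)))

  product-mono-≤ : ∀ {n} {t t′ : Vector ℕ n} → (∀ i → t i ≤ t′ i) → product t ≤ product t′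
  product-mono-≤ {zero}  _    = ≤-refl
  product-mono-≤ {suc n} t≤t′ = *-mono-≤ (t≤t′ zero) (product-mono-≤ (t≤t′ ∘ suc))

  sum-update : ∀ {n} (t t′ : Vector ℕ n) i → (∀ j → j ≢ i → t′ j ≡ t j) → sum t′ + t i ≡ sum t + t′ i
  sum-update {suc n} = UpdateSum.sum-update +-0-commutativeMonoid

  product-update : ∀ {n} (t t′ : Vector ℕ n) i → (∀ j → j ≢ i → t′ j ≡ t j) → product t′ * t i ≡ product t * t′ i
  product-update {suc n} = UpdateSum.sum-update *-1-commutativeMonoid

  sum-update₂ : ∀ {n} (t t′ : Vector ℕ n) a b → a ≢ b → (∀ v → v ≢ a → v ≢ b → t′ v ≡ t v) →
                sum t′ + (t a + t b) ≡ sum t + (t′ a + t′ b)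
  sum-update₂ {n} t t′ a b a≢b t′≡t = begin
    sum t′ + (t a + t b)         ≡⟨ x+[y+z]≡x+z+y (sum t′) (t a) (t b) ⟩
    sum t′ + t b + t a           ≡⟨ cong (λ z → sum t′ + z + t a) (sym tₐ[b]≡t[b]) ⟩
    sum t′ + tₐ b + t a          ≡⟨ cong (_+ t a) (sum-update tₐ t′ b t′≡tₐ) ⟩
    sum tₐ + t′ b + t a          ≡⟨ x+y+z≡x+z+y (sum tₐ) (t′ b) (t a) ⟩
    sum tₐ + t a + t′ b          ≡⟨ cong (_+ t′ b) (sum-update t tₐ a tₐ≡t) ⟩
    sum t + tₐ a + t′ b          ≡⟨ cong (λ z → sum t + z + t′ b) tₐ[a]≡t′[a] ⟩
    sum t + t′ a + t′ b          ≡⟨ +-assoc (sum t) (t′ a) (t′ b) ⟩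
    sum t + (t′ a + t′ b)        ∎
    where
    open ≡-Reasoning
    x+[y+z]≡x+z+y : ∀ x y z → x + (y + z) ≡ x + z + y
    x+[y+z]≡x+z+y = solve-∀
    x+y+z≡x+z+y : ∀ x y z → x + y + z ≡ x + z + y
    x+y+z≡x+z+y = solve-∀
    tₐ : Vector ℕ n
    tₐ v with v Fin.≟ a
    ... | yes _ = t′ a
    ... | no  _ = t v
    tₐ[a]≡t′[a] : tₐ a ≡ t′ a
    tₐ[a]≡t′[a] with a Fin.≟ a
    ... | yes _   = refl
    ... | no  a≢a = contradiction refl a≢a
    tₐ[b]≡t[b] : tₐ b ≡ t b
    tₐ[b]≡t[b] with b Fin.≟ a
    ... | yes b≡a = contradiction (sym b≡a) a≢b
    ... | no  _   = refl
    tₐ≡t : ∀ v → v ≢ a → tₐ v ≡ t v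
    tₐ≡t v v≢a with v Fin.≟ a
    ... | yes v≡a = contradiction v≡a v≢a
    ... | no  _   = refl
    t′≡tₐ : ∀ v → v ≢ b → t′ v ≡ tₐ v
    t′≡tₐ v v≢b with v Fin.≟ a
    ... | yes refl = refl
    ... | no  v≢a  = t′≡t v v≢a v≢b

  product-lower-bound : ∀ {n d} (t : Vector ℕ n) (ℓ : Fin d → Fin n) → Injective _≡_ _≡_ ℓ → ∀ {lo hi} →
                        (∀ i → lo ≤ t i) → (∀ i → hi ≤ t (ℓ i)) → hi ^ d * lo ^ (n ∸ d) ≤ product t
  product-lower-bound {n} {zero} t ℓ ℓ-inj {lo} lo≤t _ = begin
    1 * lo ^ n              ≡⟨ *-identityˡ (lo ^ n) ⟩
    lo ^ n                  ≡⟨ sym (product-const n lo) ⟩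
    product {n} (λ _ → lo)  ≤⟨ product-mono-≤ lo≤t ⟩
    product t               ∎
    where open ≤-Reasoning
  product-lower-bound {zero}  {suc d} t ℓ _ _ _ with ℓ zero
  ... | ()
  product-lower-bound {suc n} {suc d} t ℓ ℓ-inj {lo} {hi} lo≤t hi≤t∘ℓ = begin
    hi * hi ^ d * lo ^ (n ∸ d)                   ≡⟨ *-assoc hi (hi ^ d) (lo ^ (n ∸ d)) ⟩
    hi * (hi ^ d * lo ^ (n ∸ d))                 ≤⟨ *-mono-≤ (hi≤t∘ℓ zero)
                                                              (product-lower-bound (removeAt t (ℓ zero)) ℓ′ ℓ′-inj
                                                                                   (lo≤t ∘ punchIn (ℓ zero)) hi≤t∘ℓ′) ⟩
    t (ℓ zero) * product (removeAt t (ℓ zero))   ≡⟨ sym (Π.sum-remove {i = ℓ zero} t) ⟩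
    product t                                    ∎
    where
    open ≤-Reasoning
    ℓ[1+i]≢ℓ0 : ∀ i → ℓ zero ≢ ℓ (suc i)
    ℓ[1+i]≢ℓ0 i eq with ℓ-inj eq
    ... | ()
    ℓ′ : Fin d → Fin n
    ℓ′ i = punchOut (ℓ[1+i]≢ℓ0 i)
    punchIn-ℓ′ : ∀ i → punchIn (ℓ zero) (ℓ′ i) ≡ ℓ (suc i)
    punchIn-ℓ′ i = Fin.punchIn-punchOut (ℓ[1+i]≢ℓ0 i)
    ℓ′-inj : Injective _≡_ _≡_ ℓ′
    ℓ′-inj {i} {j} eq =
      Fin.suc-injective (ℓ-inj (trans (sym (punchIn-ℓ′ i)) (trans (cong (punchIn (ℓ zero)) eq) (punchIn-ℓ′ j))))
    hi≤t∘ℓ′ : ∀ i → hi ≤ removeAt t (ℓ zero) (ℓ′ i)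
    hi≤t∘ℓ′ i = subst (λ v → hi ≤ t v) (sym (punchIn-ℓ′ i)) (hi≤t∘ℓ (suc i))

module Board (N : ℕ) where
  open import Defs
  open import Data.Fin as Fin using (Fin)
  import Data.Fin.Properties as Fin
  open import Data.List using (List)
  import Data.List.Membership.DecPropositional as DecMembership
  open import Data.Product using (_,_)
  open import Data.Product.Properties using (≡-dec)
  open import Relation.Nullary using (Dec; ¬?)
  open import Relation.Nullary.Decidable using (_⊎-dec_; _×-dec_)

  open DecMembership (≡-dec (Fin._≟_ {N}) (Fin._≟_ {N})) public using (_∈?_)

  EdgeRel? : ∀ es u v → Dec (EdgeRel {N} es u v)
  EdgeRel? es u v = ((u , v) ∈? es) ⊎-dec ((v , u) ∈? es)

  Free? : ∀ B R (e : Edge N) → Dec (Free e B R)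
  Free? B R (u , v) = (u Fin.<? v) ×-dec (¬? ((u , v) ∈? B) ×-dec ¬? ((u , v) ∈? R))

module BobsPotential (N d p q : ℕ) where
  open NatSums
  open import Defs
  open import Data.Nat
  open import Data.Nat.Properties
  open import Data.Nat.Tactic.RingSolver using (solve-∀)
  open import Data.Bool using (Bool; true; false; if_then_else_)
  open import Data.Fin as Fin using (Fin; zero; suc)
  import Data.Fin.Properties as Fin
  open import Data.List using (List; []; _∷_; allFin; cartesianProduct; filter)
  open import Data.List.Extrema.Nat using (argmax; argmax-all; f[xs]≤f[argmax])
  open import Data.List.Membership.Propositional using (_∈_; _∉_)
  open import Data.List.Membership.Propositional.Properties using (∈-allFin; ∈-cartesianProduct⁺; ∈-filter⁺)
  open import Data.List.Relation.Unary.All as All using (All)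
  open import Data.List.Relation.Unary.All.Properties using (all-filter)
  open import Data.List.Relation.Unary.Any using (here; there)
  open import Data.Product using (Σ; ∃; _×_; _,_; proj₁; proj₂)
  open import Data.Sum as Sum using (inj₁; inj₂)
  open import Function using (_∘_)
  open import Relation.Binary.PropositionalEquality
  open import Relation.Nullary using (¬_; does; contradiction)
  open import Relation.Nullary.Decidable using (dec-true; dec-false; does-⇔; proof)
  open import Relation.Nullary.Reflects using (Reflects; invert)
  open import Function.Bundles using (mk⇔)

  open Board N using (EdgeRel?; Free?)

  joined : List (Edge N) → Fin N → Fin N → Bool
  joined es u v = does (EdgeRel? es u v)

  joined-[] : ∀ u v → joined [] u v ≡ false
  joined-[] u v = dec-false (EdgeRel? [] u v) λ { (inj₁ ()) ; (inj₂ ()) }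

  joined-∷ : ∀ e es u v → joined es u v ≡ true → joined (e ∷ es) u v ≡ true
  joined-∷ e es u v joined≡true = dec-true (EdgeRel? (e ∷ es) u v) (Sum.map there there rel)
    where
    rel : EdgeRel es u v
    rel = invert (subst (Reflects _) joined≡true (proof (EdgeRel? es u v)))

  joined-∷-ab : ∀ es a b → joined ((a , b) ∷ es) a b ≡ true
  joined-∷-ab es a b = dec-true (EdgeRel? ((a , b) ∷ es) a b) (inj₁ (here refl))

  joined-∷-ba : ∀ es a b → joined ((a , b) ∷ es) b a ≡ true
  joined-∷-ba es a b = dec-true (EdgeRel? ((a , b) ∷ es) b a) (inj₂ (here refl))

  joined-∷-other : ∀ es a b u v → ¬ (u ≡ a × v ≡ b) → ¬ (u ≡ b × v ≡ a) →
                   joined ((a , b) ∷ es) u v ≡ joined es u v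
  joined-∷-other es a b u v ¬ab ¬ba = does-⇔ (mk⇔ drop (Sum.map there there)) (EdgeRel? _ u v) (EdgeRel? es u v)
    where
    drop : EdgeRel ((a , b) ∷ es) u v → EdgeRel es u v
    drop (inj₁ (here refl))  = contradiction (refl , refl) ¬ab
    drop (inj₁ (there u,v∈)) = inj₁ u,v∈
    drop (inj₂ (here refl))  = contradiction (refl , refl) ¬ba
    drop (inj₂ (there v,u∈)) = inj₂ v,u∈

  -- Free only tests the orientation (u , v) with u < v, so coloured edges are kept in that orientation.
  Ordered : List (Edge N) → Set
  Ordered es = ∀ {u v} → (u , v) ∈ es → u Fin.< v

  Ordered-∷ : ∀ {es B R} e → Free e B R → Ordered es → Ordered (e ∷ es)
  Ordered-∷ _ (u<v , _) _     (here refl) = u<v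
  Ordered-∷ _ _         ord-es (there e∈) = ord-es e∈

  Unjoined : List (Edge N) → Edge N → Set
  Unjoined es (a , b) = joined es a b ≡ false × joined es b a ≡ false

  free⇒unjoined : ∀ es a b → Ordered es → a Fin.< b → (a , b) ∉ es → Unjoined es (a , b)
  free⇒unjoined es a b ord a<b ab∉ =
    dec-false (EdgeRel? es a b) (λ { (inj₁ ab∈) → ab∉ ab∈ ; (inj₂ ba∈) → Fin.<-asym a<b (ord ba∈) }) ,
    dec-false (EdgeRel? es b a) (λ { (inj₁ ba∈) → Fin.<-asym a<b (ord ba∈) ; (inj₂ ab∈) → ab∉ ab∈ })

  -- q times the usual weights 1 + p/q, 1 - p/q and 1 of a blue, red and free pair; the pair
  -- (u , u) is never joined, so it contributes the harmless constant factor q.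
  factor : List (Edge N) → List (Edge N) → Fin N → Fin N → ℕ
  factor B R u v = if joined B u v then q + p else if joined R u v then q ∸ p else q

  vertexWeight : List (Edge N) → List (Edge N) → Fin N → ℕ
  vertexWeight B R u = product (factor B R u)

  totalWeight : List (Edge N) → List (Edge N) → ℕ
  totalWeight B R = sum (vertexWeight B R)

  edgeWeight : List (Edge N) → List (Edge N) → Edge N → ℕ
  edgeWeight B R (u , v) = vertexWeight B R u + vertexWeight B R v

  factor-unjoined : ∀ B R u v → joined B u v ≡ false → joined R u v ≡ false → factor B R u v ≡ q
  factor-unjoined B R u v b≡false r≡false rewrite b≡false | r≡false = refl

  q∸p≤factor : ∀ B R u v → q ∸ p ≤ factor B R u v
  q∸p≤factor B R u v with joined B u v | joined R u v
  ... | true  | _     = ≤-trans (m∸n≤m q p) (m≤m+n q p)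
  ... | false | true  = ≤-refl
  ... | false | false = m∸n≤m q p

  factor-∷ʳ-≤ : ∀ B R e u v → factor B (e ∷ R) u v ≤ factor B R u v
  factor-∷ʳ-≤ B R e u v with joined B u v | joined R u v in r≡ | joined (e ∷ R) u v in r′≡
  ... | true  | _     | _     = ≤-refl
  ... | false | true  | true  = ≤-refl
  ... | false | true  | false = contradiction (trans (sym (joined-∷ e R u v r≡)) r′≡) λ ()
  ... | false | false | true  = m∸n≤m q p
  ... | false | false | false = ≤-refl

  edgeWeight-∷ʳ-≤ : ∀ B R e g → edgeWeight B (e ∷ R) g ≤ edgeWeight B R g
  edgeWeight-∷ʳ-≤ B R e (u , v) =
    +-mono-≤ (product-mono-≤ (factor-∷ʳ-≤ B R e u)) (product-mono-≤ (factor-∷ʳ-≤ B R e v))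

  recolour : ∀ (F F′ : Fin N → Fin N → ℕ) a b c → a ≢ b →
             (∀ u v → ¬ (u ≡ a × v ≡ b) → ¬ (u ≡ b × v ≡ a) → F′ u v ≡ F u v) →
             F a b ≡ q → F b a ≡ q → F′ a b ≡ c → F′ b a ≡ c →
             q * sum (product ∘ F′) + q * (product (F a) + product (F b))
               ≡ q * sum (product ∘ F) + c * (product (F a) + product (F b))
  recolour F F′ a b c a≢b F′≡F Fab≡q Fba≡q F′ab≡c F′ba≡c = begin
    q * sum (product ∘ F′) + q * (product (F a) + product (F b))
      ≡⟨ cong₂ _+_ (*-distribˡ-sum q (product ∘ F′)) (*-distribˡ-+ q (product (F a)) (product (F b))) ⟩
    sum (λ u → q * product (F′ u)) + (q * product (F a) + q * product (F b))
      ≡⟨ sum-update₂ (λ u → q * product (F u)) (λ u → q * product (F′ u)) a b a≢b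
           (λ u u≢a u≢b → cong (q *_) (product-cong (λ v → F′≡F u v (u≢a ∘ proj₁) (u≢b ∘ proj₁)))) ⟩
    sum (λ u → q * product (F u)) + (q * product (F′ a) + q * product (F′ b))
      ≡⟨ cong₂ _+_ (sym (*-distribˡ-sum q (product ∘ F)))
                   (cong₂ _+_ (rescaled a b Fab≡q F′ab≡c (λ v v≢b → F′≡F a v (v≢b ∘ proj₂) (a≢b ∘ proj₁)))
                              (rescaled b a Fba≡q F′ba≡c (λ v v≢a → F′≡F b v (a≢b ∘ sym ∘ proj₁) (v≢a ∘ proj₂)))) ⟩
    q * sum (product ∘ F) + (c * product (F a) + c * product (F b))
      ≡⟨ cong (q * sum (product ∘ F) +_) (sym (*-distribˡ-+ c (product (F a)) (product (F b)))) ⟩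
    q * sum (product ∘ F) + c * (product (F a) + product (F b)) ∎
    where
    open ≡-Reasoning
    rescaled : ∀ x y → F x y ≡ q → F′ x y ≡ c → (∀ v → v ≢ y → F′ x v ≡ F x v) →
               q * product (F′ x) ≡ c * product (F x)
    rescaled x y Fxy≡q F′xy≡c F′x≡Fx = begin
      q * product (F′ x)       ≡⟨ *-comm q _ ⟩
      product (F′ x) * q       ≡⟨ cong (product (F′ x) *_) (sym Fxy≡q) ⟩
      product (F′ x) * F x y   ≡⟨ product-update (F x) (F′ x) y F′x≡Fx ⟩
      product (F x) * F′ x y   ≡⟨ cong (product (F x) *_) F′xy≡c ⟩
      product (F x) * c        ≡⟨ *-comm (product (F x)) c ⟩
      c * product (F x)        ∎

  Uncoloured : List (Edge N) → List (Edge N) → Edge N → Set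
  Uncoloured B R (a , b) = a ≢ b × Unjoined B (a , b) × Unjoined R (a , b)

  free⇒uncoloured : ∀ {B R} → Ordered B → Ordered R → ∀ e → Free e B R → Uncoloured B R e
  free⇒uncoloured {B} {R} ord-B ord-R (a , b) (a<b , ab∉B , ab∉R) =
    Fin.<⇒≢ a<b , free⇒unjoined B a b ord-B a<b ab∉B , free⇒unjoined R a b ord-R a<b ab∉R

  blue-step : ∀ B R a b → Uncoloured B R (a , b) →
              q * totalWeight ((a , b) ∷ B) R ≡ q * totalWeight B R + p * edgeWeight B R (a , b)
  blue-step B R a b (a≢b , (abB , baB) , (abR , baR)) = +-cancelʳ-≡ (q * W) _ _ (begin
    q * totalWeight B′ R + q * W
      ≡⟨ recolour (factor B R) (factor B′ R) a b (q + p) a≢b agree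
           (factor-unjoined B R a b abB abR) (factor-unjoined B R b a baB baR) blue-ab blue-ba ⟩
    q * totalWeight B R + (q + p) * W
      ≡⟨ x+[q+p]w≡x+pw+qw (q * totalWeight B R) q p W ⟩
    q * totalWeight B R + p * W + q * W ∎)
    where
    open ≡-Reasoning
    B′ : List (Edge N)
    B′ = (a , b) ∷ B
    W : ℕ
    W = edgeWeight B R (a , b)
    x+[q+p]w≡x+pw+qw : ∀ x q p w → x + (q + p) * w ≡ x + p * w + q * w
    x+[q+p]w≡x+pw+qw = solve-∀
    agree : ∀ u v → ¬ (u ≡ a × v ≡ b) → ¬ (u ≡ b × v ≡ a) → factor B′ R u v ≡ factor B R u v
    agree u v ¬ab ¬ba rewrite joined-∷-other B a b u v ¬ab ¬ba = refl
    blue-ab : factor B′ R a b ≡ q + p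
    blue-ab rewrite joined-∷-ab B a b = refl
    blue-ba : factor B′ R b a ≡ q + p
    blue-ba rewrite joined-∷-ba B a b = refl

  red-step : p ≤ q → ∀ B R a b → Uncoloured B R (a , b) →
             q * totalWeight B ((a , b) ∷ R) + p * edgeWeight B R (a , b) ≡ q * totalWeight B R
  red-step p≤q B R a b (a≢b , (abB , baB) , (abR , baR)) = +-cancelʳ-≡ ((q ∸ p) * W) _ _ (begin
    q * totalWeight B R′ + p * W + (q ∸ p) * W
      ≡⟨ x+pw+rw≡x+[p+r]w (q * totalWeight B R′) p (q ∸ p) W ⟩
    q * totalWeight B R′ + (p + (q ∸ p)) * W
      ≡⟨ cong (λ z → q * totalWeight B R′ + z * W) (m+[n∸m]≡n p≤q) ⟩
    q * totalWeight B R′ + q * W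
      ≡⟨ recolour (factor B R) (factor B R′) a b (q ∸ p) a≢b agree
           (factor-unjoined B R a b abB abR) (factor-unjoined B R b a baB baR) red-ab red-ba ⟩
    q * totalWeight B R + (q ∸ p) * W ∎)
    where
    open ≡-Reasoning
    R′ : List (Edge N)
    R′ = (a , b) ∷ R
    W : ℕ
    W = edgeWeight B R (a , b)
    x+pw+rw≡x+[p+r]w : ∀ x p r w → x + p * w + r * w ≡ x + (p + r) * w
    x+pw+rw≡x+[p+r]w = solve-∀
    agree : ∀ u v → ¬ (u ≡ a × v ≡ b) → ¬ (u ≡ b × v ≡ a) → factor B R′ u v ≡ factor B R u v
    agree u v ¬ab ¬ba rewrite joined-∷-other R a b u v ¬ab ¬ba = refl
    red-ab : factor B R′ a b ≡ q ∸ p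
    red-ab rewrite abB | joined-∷-ab R a b = refl
    red-ba : factor B R′ b a ≡ q ∸ p
    red-ba rewrite baB | joined-∷-ba R a b = refl

  -- On the empty board q * totalWeight + p * edgeWeight g is exactly q * budget.
  budget : ℕ
  budget = q ^ (N ∸ 1) * (N * q + 2 * p)

  Invariant : List (Edge N) → List (Edge N) → Set
  Invariant B R =
    Ordered B × Ordered R × (∀ g → Free g B R → q * totalWeight B R + p * edgeWeight B R g ≤ q * budget)

  invariant-start : 0 < N → Invariant [] []
  invariant-start 0<N = (λ ()) , (λ ()) , λ (a , b) _ → ≤-reflexive (start a b)
    where
    vertexWeight-[] : ∀ u → vertexWeight [] [] u ≡ q ^ N
    vertexWeight-[] u =
      trans (product-cong (λ v → factor-unjoined [] [] u v (joined-[] u v) (joined-[] u v))) (product-const N q)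
    q^N≡q*q^[N∸1] : q ^ N ≡ q * q ^ (N ∸ 1)
    q^N≡q*q^[N∸1] = cong (q ^_) (sym (m+[n∸m]≡n 0<N))
    identity : ∀ q p n x → q * (n * (q * x)) + p * (q * x + q * x) ≡ q * (x * (n * q + 2 * p))
    identity = solve-∀
    start : ∀ a b → q * totalWeight [] [] + p * edgeWeight [] [] (a , b) ≡ q * budget
    start a b = begin
      q * sum (vertexWeight [] []) + p * (vertexWeight [] [] a + vertexWeight [] [] b)
        ≡⟨ cong₂ (λ x y → q * x + p * y) (trans (sum-cong vertexWeight-[]) (sum-const N (q ^ N)))
                                          (cong₂ _+_ (vertexWeight-[] a) (vertexWeight-[] b)) ⟩
      q * (N * q ^ N) + p * (q ^ N + q ^ N)
        ≡⟨ cong (λ z → q * (N * z) + p * (z + z)) q^N≡q*q^[N∸1] ⟩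
      q * (N * (q * q ^ (N ∸ 1))) + p * (q * q ^ (N ∸ 1) + q * q ^ (N ∸ 1))
        ≡⟨ identity q p N (q ^ (N ∸ 1)) ⟩
      q * budget ∎
      where open ≡-Reasoning

  blue-star-weight : ∀ B R → HasCopy (Star d) B → ∃ λ c → (q + p) ^ d * (q ∸ p) ^ (N ∸ d) ≤ vertexWeight B R c
  blue-star-weight B R (f , f-inj , f-adj) =
    f zero ,
    product-lower-bound (factor B R (f zero)) (f ∘ suc) (Fin.suc-injective ∘ f-inj) (q∸p≤factor B R (f zero)) blue-leaf
    where
    blue-leaf : ∀ i → q + p ≤ factor B R (f zero) (f (suc i))
    blue-leaf i rewrite dec-true (EdgeRel? B (f zero) (f (suc i))) (f-adj zero (suc i) (inj₁ (refl , λ ()))) = ≤-refl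

  allEdges : List (Edge N)
  allEdges = cartesianProduct (allFin N) (allFin N)

  bobsReply : List (Edge N) → List (Edge N) → Edge N → Edge N
  bobsReply B R e₀ = argmax (edgeWeight B R) e₀ (filter (Free? B R) allEdges)

  bobsReply-free : ∀ {B R e₀} → Free e₀ B R → Free (bobsReply B R e₀) B R
  bobsReply-free {B} {R} e₀-free = argmax-all (edgeWeight B R) e₀-free (all-filter (Free? B R) allEdges)

  bobsReply-maximal : ∀ {B R} e₀ g → Free g B R → edgeWeight B R g ≤ edgeWeight B R (bobsReply B R e₀)
  bobsReply-maximal {B} {R} e₀ (u , v) g-free =
    All.lookup (f[xs]≤f[argmax] e₀ _)
               (∈-filter⁺ (Free? B R) (∈-cartesianProduct⁺ (∈-allFin u) (∈-allFin v)) g-free)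

  invariant-step : p ≤ q → ∀ {B R e f} → Invariant B R → Free e B R → Free f (e ∷ B) R →
                   (∀ g → Free g (e ∷ B) R → edgeWeight (e ∷ B) R g ≤ edgeWeight (e ∷ B) R f) →
                   Invariant (e ∷ B) (f ∷ R)
  invariant-step p≤q {B} {R} {e} {f} (ord-B , ord-R , bounded) e-free f-free f-max =
    ord-B′ , Ordered-∷ f f-free ord-R , λ g (u<v , g∉B′ , g∉f∷R) → begin
      q * totalWeight B′ (f ∷ R) + p * edgeWeight B′ (f ∷ R) g
        ≤⟨ +-monoʳ-≤ (q * totalWeight B′ (f ∷ R)) (*-monoʳ-≤ p (edgeWeight-∷ʳ-≤ B′ R f g)) ⟩
      q * totalWeight B′ (f ∷ R) + p * edgeWeight B′ R g
        ≤⟨ +-monoʳ-≤ (q * totalWeight B′ (f ∷ R)) (*-monoʳ-≤ p (f-max g (u<v , g∉B′ , g∉f∷R ∘ there))) ⟩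
      q * totalWeight B′ (f ∷ R) + p * edgeWeight B′ R f
        ≡⟨ red-step p≤q B′ R (proj₁ f) (proj₂ f) (free⇒uncoloured ord-B′ ord-R f f-free) ⟩
      q * totalWeight B′ R
        ≡⟨ blue-step B R (proj₁ e) (proj₂ e) (free⇒uncoloured ord-B ord-R e e-free) ⟩
      q * totalWeight B R + p * edgeWeight B R e
        ≤⟨ bounded e e-free ⟩
      q * budget ∎
    where
    open ≤-Reasoning
    B′ : List (Edge N)
    B′ = e ∷ B
    ord-B′ : Ordered B′
    ord-B′ = Ordered-∷ e e-free ord-B

  potential-bound-from : .{{_ : NonZero q}} → p ≤ q → ∀ {B R} → AliceWins (Star d) N B R → Invariant B R →
                         (q + p) ^ d * (q ∸ p) ^ (N ∸ d) ≤ budget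
  potential-bound-from p≤q {B} {R} (win-now e e-free copy) (ord-B , ord-R , bounded) =
    ≤-trans star≤weight (≤-trans (≤-sum (vertexWeight (e ∷ B) R) centre) (*-cancelˡ-≤ q total≤budget))
    where
    open Σ (blue-star-weight (e ∷ B) R copy) renaming (proj₁ to centre; proj₂ to star≤weight)
    total≤budget : q * totalWeight (e ∷ B) R ≤ q * budget
    total≤budget = ≤-trans (≤-reflexive (blue-step B R (proj₁ e) (proj₂ e) (free⇒uncoloured ord-B ord-R e e-free)))
                           (bounded e e-free)
  potential-bound-from p≤q {B} {R} (continue e e-free (e₀ , e₀-free) next) inv =
    potential-bound-from p≤q (proj₂ (next f f-free)) (invariant-step p≤q inv e-free f-free (bobsReply-maximal e₀))
    where
    f : Edge N
    f = bobsReply (e ∷ B) R e₀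
    f-free : Free f (e ∷ B) R
    f-free = bobsReply-free e₀-free

  potential-bound : .{{_ : NonZero q}} → p ≤ q → 0 < N → AliceWinsOn (Star d) N →
                    (q + p) ^ d * (q ∸ p) ^ (N ∸ d) ≤ q ^ (N ∸ 1) * (N * q + 2 * p)
  potential-bound p≤q 0<N alice-wins = potential-bound-from p≤q alice-wins (invariant-start 0<N)

module StarCopies where
  open import Defs
  open import Data.Nat
  open import Data.Nat.Properties
  open import Data.Fin using (Fin; zero; suc)
  import Data.Fin.Properties as Fin
  open import Data.List using (List; length; lookup)
  open import Data.List.Membership.Propositional using (_∈_)
  import Data.List.Relation.Unary.Any as Any
  open import Data.List.Relation.Unary.Any.Properties using (lookup-index)
  open import Data.Product using (_,_; proj₁; proj₂)
  open import Data.Sum using (inj₁; inj₂)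
  open import Function.Definitions using (Injective)
  open import Relation.Binary.PropositionalEquality
  open import Relation.Nullary using (contradiction)

  injection⇒≤length : ∀ {A : Set} (xs : List A) {m} (h : Fin m → A) → Injective _≡_ _≡_ h → (∀ i → h i ∈ xs) →
                      m ≤ length xs
  injection⇒≤length xs h h-inj h∈xs = Fin.injective⇒≤ {f = λ i → Any.index (h∈xs i)} λ {i} {j} eq →
    h-inj (trans (lookup-index (h∈xs i)) (trans (cong (lookup xs) eq) (sym (lookup-index (h∈xs j)))))

  copy⇒≤size : ∀ {G N} {es : List (Edge N)} → HasCopy G es → size G ≤ N
  copy⇒≤size (f , f-inj , _) = Fin.injective⇒≤ f-inj

  star-copy⇒≤length : ∀ {d N} (es : List (Edge N)) → HasCopy (Star d) es → d ≤ length es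
  star-copy⇒≤length {d} es (f , f-inj , f-adj) = injection⇒≤length es spoke spoke-inj spoke∈es
    where
    centre≢leaf : ∀ i → f zero ≢ f (suc i)
    centre≢leaf i eq with f-inj eq
    ... | ()
    spoke′ : ∀ i → EdgeRel es (f zero) (f (suc i)) → Edge _
    spoke′ i (inj₁ _) = f zero , f (suc i)
    spoke′ i (inj₂ _) = f (suc i) , f zero
    incident : ∀ i → EdgeRel es (f zero) (f (suc i))
    incident i = f-adj zero (suc i) (inj₁ (refl , λ ()))
    spoke : Fin d → Edge _
    spoke i = spoke′ i (incident i)
    spoke∈es : ∀ i → spoke i ∈ es
    spoke∈es i with incident i
    ... | inj₁ ∈es = ∈es
    ... | inj₂ ∈es = ∈es
    spoke-inj : Injective _≡_ _≡_ spoke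
    spoke-inj {i} {j} eq with incident i | incident j
    ... | inj₁ _ | inj₁ _ = Fin.suc-injective (f-inj (cong proj₂ eq))
    ... | inj₁ _ | inj₂ _ = contradiction (cong proj₁ eq) (centre≢leaf j)
    ... | inj₂ _ | inj₁ _ = contradiction (sym (cong proj₁ eq)) (centre≢leaf i)
    ... | inj₂ _ | inj₂ _ = Fin.suc-injective (f-inj (cong proj₁ eq))

module AlicesStrategy (d′ : ℕ) where
  open import Defs
  open StarCopies using (injection⇒≤length; star-copy⇒≤length)
  open import Data.Nat
  open import Data.Nat.Properties
  open import Data.Fin as Fin using (Fin; zero; suc)
  import Data.Fin.Properties as Fin
  open import Data.List using (List; []; _∷_; length; _++_)
  open import Data.List.Properties using (length-++)
  open import Data.List.Membership.Propositional using (_∈_; _∉_)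
  open import Data.List.Membership.Propositional.Properties using (∈-++⁺ˡ; ∈-++⁺ʳ)
  open import Data.List.Relation.Unary.Any using (here; there)
  open import Data.Product using (Σ; ∃; _×_; _,_; proj₁; proj₂)
  open import Data.Sum using (inj₁; inj₂)
  open import Function.Definitions using (Injective)
  open import Relation.Binary.PropositionalEquality
  open import Relation.Nullary using (¬_; yes; no; contradiction)

  d M N : ℕ
  d = suc d′
  M = d′ + d
  N = suc M

  open Board N using (_∈?_; Free?)

  StarAtZero : ℕ → List (Edge N) → Set
  StarAtZero t B = Σ (Fin t → Fin M) λ ℓ → Injective _≡_ _≡_ ℓ × (∀ i → (zero , suc (ℓ i)) ∈ B)

  StarAtZero-[] : StarAtZero 0 []
  StarAtZero-[] = (λ ()) , (λ { {()} }) , (λ ())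

  StarAtZero-∷ : ∀ {t B} j → (zero , suc j) ∉ B → StarAtZero t B → StarAtZero (suc t) ((zero , suc j) ∷ B)
  StarAtZero-∷ {t} {B} j j∉B (ℓ , ℓ-inj , ℓ∈B) = ℓ′ , ℓ′-inj , ℓ′∈
    where
    j≢ℓ : ∀ i → j ≢ ℓ i
    j≢ℓ i refl = j∉B (ℓ∈B i)
    ℓ′ : Fin (suc t) → Fin M
    ℓ′ zero    = j
    ℓ′ (suc i) = ℓ i
    ℓ′-inj : Injective _≡_ _≡_ ℓ′
    ℓ′-inj {zero}  {zero}  _  = refl
    ℓ′-inj {zero}  {suc i} eq = contradiction eq (j≢ℓ i)
    ℓ′-inj {suc i} {zero}  eq = contradiction (sym eq) (j≢ℓ i)
    ℓ′-inj {suc i} {suc k} eq = cong suc (ℓ-inj eq)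
    ℓ′∈ : ∀ i → (zero , suc (ℓ′ i)) ∈ (zero , suc j) ∷ B
    ℓ′∈ zero    = here refl
    ℓ′∈ (suc i) = there (ℓ∈B i)

  StarAtZero⇒copy : ∀ {B} → StarAtZero d B → HasCopy (Star d) B
  StarAtZero⇒copy {B} (ℓ , ℓ-inj , ℓ∈B) = f , f-inj , f-adj
    where
    f : Fin (suc d) → Fin N
    f zero    = zero
    f (suc i) = suc (ℓ i)
    f-inj : Injective _≡_ _≡_ f
    f-inj {zero}  {zero}  _  = refl
    f-inj {suc i} {suc k} eq = cong suc (ℓ-inj (Fin.suc-injective eq))
    f-adj : ∀ u v → Adj (Star d) u v → EdgeRel B (f u) (f v)
    f-adj .zero (suc i) (inj₁ (refl , _))   = inj₁ (ℓ∈B i)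
    f-adj .zero zero    (inj₁ (refl , 0≢0)) = contradiction refl 0≢0
    f-adj (suc i) .zero (inj₂ (refl , _))   = inj₂ (ℓ∈B i)
    f-adj zero    .zero (inj₂ (refl , 0≢0)) = contradiction refl 0≢0

  free-spoke : ∀ B R → length B + length R < M → ∃ λ j → Free (zero , suc j) B R
  free-spoke B R room with Fin.any? (λ j → Free? B R (zero , suc j))
  ... | yes found = found
  ... | no  none  = contradiction (injection⇒≤length (B ++ R) spoke spoke-inj taken)
                                  (<⇒≱ (subst (_< M) (sym (length-++ B)) room))
    where
    spoke : Fin M → Edge N
    spoke j = zero , suc j
    spoke-inj : Injective _≡_ _≡_ spoke
    spoke-inj eq = Fin.suc-injective (cong proj₂ eq)
    taken : ∀ j → spoke j ∈ B ++ R
    taken j with spoke j ∈? B | spoke j ∈? R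
    ... | yes ∈B | _     = ∈-++⁺ˡ ∈B
    ... | no  _  | yes ∈R = ∈-++⁺ʳ B ∈R
    ... | no  ∉B | no ∉R  = contradiction (j , z<s , ∉B , ∉R) none

  room : ∀ {a b} → a ≤ d′ → b ≤ d′ → a + b < M
  room a≤d′ b≤d′ = ≤-trans (s≤s (+-mono-≤ a≤d′ b≤d′)) (≤-reflexive (sym (+-suc d′ d′)))

  strategy : ∀ r t → r + t ≡ d′ → ∀ {B R} → length B ≡ t → length R ≡ t → StarAtZero t B →
             AliceWins (Star d) N B R
  strategy zero _ refl {B} {R} |B|≡d′ |R|≡d′ star =
    win-now (zero , suc j) j-free (StarAtZero⇒copy (StarAtZero-∷ j (proj₁ (proj₂ j-free)) star))
    where
    open Σ (free-spoke B R (room (≤-reflexive |B|≡d′) (≤-reflexive |R|≡d′)))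
      renaming (proj₁ to j; proj₂ to j-free)
  strategy (suc r) t 1+r+t≡d′ {B} {R} |B|≡t |R|≡t star =
    continue (zero , suc j) j-free ((zero , suc j′) , j′-free) reply
    where
    t<d′ : t < d′
    t<d′ = subst (t <_) 1+r+t≡d′ (s≤s (m≤n+m t r))
    |B|<d′ : length B < d′
    |B|<d′ = subst (_< d′) (sym |B|≡t) t<d′
    |R|<d′ : length R < d′
    |R|<d′ = subst (_< d′) (sym |R|≡t) t<d′
    open Σ (free-spoke B R (room (<⇒≤ |B|<d′) (<⇒≤ |R|<d′))) renaming (proj₁ to j; proj₂ to j-free)
    B′ : List (Edge N)
    B′ = (zero , suc j) ∷ B
    open Σ (free-spoke B′ R (room |B|<d′ (<⇒≤ |R|<d′))) renaming (proj₁ to j′; proj₂ to j′-free)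
    reply : ∀ e′ → Free e′ B′ R → ¬ HasCopy (Star d) (e′ ∷ R) × AliceWins (Star d) N B′ (e′ ∷ R)
    reply e′ _ = no-red-star , strategy r (suc t) (trans (+-suc r t) 1+r+t≡d′) (cong suc |B|≡t) (cong suc |R|≡t)
                                        (StarAtZero-∷ j (proj₁ (proj₂ j-free)) star)
      where
      no-red-star : ¬ HasCopy (Star d) (e′ ∷ R)
      no-red-star copy = <⇒≱ (s≤s |R|<d′) (star-copy⇒≤length (e′ ∷ R) copy)

  alice-wins : AliceWinsOn (Star d) N
  alice-wins = strategy d′ 0 (+-identityʳ d′) refl refl StarAtZero-[]

open import Defs
open import Data.Nat
open import Data.Nat.Properties
open import Data.Nat.Tactic.RingSolver using (solve-∀)
open import Data.List using (List)
open import Data.Product using (∃; ∃₂; _×_; _,_; proj₂)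
open import Relation.Binary.PropositionalEquality
open import Relation.Nullary using (yes; no; contradiction)

alice-completes-copy : ∀ {G N B R} → AliceWins G N B R → ∃ λ (es : List (Edge N)) → HasCopy G es
alice-completes-copy (win-now _ _ copy)                 = _ , copy
alice-completes-copy (continue _ _ (e₀ , e₀-free) next) = alice-completes-copy (proj₂ (next e₀ e₀-free))

c*[1+d]∸c≡c*d : ∀ c d → c * suc d ∸ c ≡ c * d
c*[1+d]∸c≡c*d c d = trans (cong (_∸ c) (*-suc c d)) (m+n∸m≡n c (c * d))

expScaled-0 : ∀ J → expScaled 0 J ≡ J !
expScaled-0 zero    = refl
expScaled-0 (suc J) = trans (+-identityʳ _) (cong (suc J *_) (expScaled-0 J))

ExpLe-0 : ∀ M → 1 ≤ M → ExpLe 0 M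
ExpLe-0 M 1≤M J = ≤-trans (≤-reflexive (trans (expScaled-0 J) (sym (*-identityˡ (J !))))) (*-monoˡ-≤ (J !) 1≤M)

between-d-and-2d : ∀ {d N} → d < N → N < 2 * d → ∃₂ λ r s → d ≡ suc r + suc s × N ≡ suc r + 2 * suc s
between-d-and-2d {d} {N} d<N N<2d with m≤n⇒∃[o]m+o≡n d<N | m≤n⇒∃[o]m+o≡n N<2d
... | s , 1+d+s≡N | r , 1+N+r≡2d = r , s , d≡ , N≡
  where
  open ≡-Reasoning
  d≡ : d ≡ suc r + suc s
  d≡ = +-cancelˡ-≡ d d (suc r + suc s) (begin
    d + d                    ≡⟨ cong (d +_) (sym (+-identityʳ d)) ⟩
    2 * d                    ≡⟨ sym 1+N+r≡2d ⟩
    suc N + r                ≡⟨ cong (λ N → suc N + r) (sym 1+d+s≡N) ⟩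
    suc (suc d + s) + r      ≡⟨ lemma d r s ⟩
    d + (suc r + suc s)      ∎)
    where
    lemma : ∀ d r s → suc (suc d + s) + r ≡ d + (suc r + suc s)
    lemma = solve-∀
  N≡ : N ≡ suc r + 2 * suc s
  N≡ = begin
    N                            ≡⟨ sym 1+d+s≡N ⟩
    suc d + s                    ≡⟨ cong (λ d → suc d + s) d≡ ⟩
    suc (suc r + suc s) + s      ≡⟨ lemma r s ⟩
    suc r + 2 * suc s            ∎
    where
    lemma : ∀ r s → suc (suc r + suc s) + s ≡ suc r + 2 * suc s
    lemma = solve-∀

lower-bound-large : ∀ {d N} → 2 ≤ d → 2 * d ≤ N → StarLowerBound (suc d) N
lower-bound-large {d} {N} 2≤d 2d≤N =
  subst (λ k → ExpLe (k * k) M) (sym k≡0) (ExpLe-0 M (m^n>0 (4 * suc d ∸ 4) {{>-nonZero 0<4d}} (4 * suc d ∸ 8)))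
  where
  M : ℕ
  M = (4 * suc d ∸ 4) ^ (4 * suc d ∸ 8)
  k≡0 : 2 * suc d ∸ 2 ∸ N ≡ 0
  k≡0 = trans (cong (_∸ N) (c*[1+d]∸c≡c*d 2 d)) (m≤n⇒m∸n≡0 2d≤N)
  0<4d : 0 < 4 * suc d ∸ 4
  0<4d = subst (0 <_) (sym (c*[1+d]∸c≡c*d 4 d)) (≤-trans (s≤s z≤n) (*-monoʳ-≤ 4 (≤-trans (s≤s z≤n) 2≤d)))

lower-bound-between : ∀ r s → let k = suc r; t = suc s; d = k + t; N = k + 2 * t in
                      AliceWinsOn (Star d) N → StarLowerBound (suc d) N
lower-bound-between r s alice-wins =
  subst₂ (λ k M → ExpLe (k * k) M) (sym k≡2d∸N) (sym M≡[4d]^m) (StarExponent.e^[k²]≤[4d]^m r s potential)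
  where
  open StarParameters r s using (k; t; d; N; m; PotentialBound)
  potential : PotentialBound
  potential = BobsPotential.potential-bound N d k N (m≤m+n k (2 * t)) (s≤s z≤n) alice-wins
  k≡2d∸N : 2 * suc d ∸ 2 ∸ N ≡ k
  k≡2d∸N = trans (cong (_∸ N) (trans (c*[1+d]∸c≡c*d 2 d) (lemma r t))) (m+n∸m≡n N k)
    where
    lemma : ∀ r t → 2 * (suc r + t) ≡ (suc r + 2 * t) + suc r
    lemma = solve-∀
  M≡[4d]^m : (4 * suc d ∸ 4) ^ (4 * suc d ∸ 8) ≡ (4 * d) ^ m
  M≡[4d]^m = cong₂ _^_ (c*[1+d]∸c≡c*d 4 d) (trans (cong (_∸ 8) (lemma r t)) (m+n∸m≡n 8 m))
    where
    lemma : ∀ r t → 4 * suc (suc r + t) ≡ 8 + 4 * (r + t)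
    lemma = solve-∀

lower-bound : ∀ d → 2 ≤ d → AchNumberSatisfies (Star d) (StarLowerBound (suc d))
lower-bound d 2≤d N alice-wins with N ≤? d | 2 * d ≤? N
... | yes N≤d | _        =
  contradiction (StarCopies.copy⇒≤size (proj₂ (alice-completes-copy alice-wins))) (<⇒≱ (s≤s N≤d))
... | no _    | yes 2d≤N = lower-bound-large 2≤d 2d≤N
... | no N≰d  | no 2d≰N with between-d-and-2d (≰⇒> N≰d) (≰⇒> 2d≰N)
...   | r , s , refl , refl = lower-bound-between r s alice-wins

upper-bound : ∀ d′ → AchNumber≤ (Star (suc d′)) (2 * suc d′)
upper-bound d′ =
  AlicesStrategy.N d′ , ≤-reflexive (cong (λ x → suc (d′ + suc x)) (sym (+-identityʳ d′))) , AlicesStrategy.alice-wins d′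

theorem4 : (n : ℕ) → 3 ≤ n →
    AchNumberSatisfies (Star (n ∸ 1)) (StarLowerBound n) × AchNumber≤ (Star (n ∸ 1)) (2 * n ∸ 2)
theorem4 (suc (suc (suc n))) (s≤s (s≤s (s≤s _))) =
  lower-bound (suc (suc n)) (s≤s (s≤s z≤n)) ,
  subst (AchNumber≤ (Star (suc (suc n)))) (sym (c*[1+d]∸c≡c*d 2 (suc (suc n)))) (upper-bound (suc n))
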